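{- Let $m\ge1$ and let $s$ be a positive integer such that $\gcd(s+m,3m)=1$. Let $U_s=\{(x^{2^s},x^{2^{m+s}}+x): x\in\mathbb{F}_{2^{3m}}\}$ and, for $\mu\in\mathbb{F}_{2^{3m}}$, $P_\mu=\langle(1,\mu)\rangle_{\mathbb{F}_{2^{3m}}}\subseteq(\mathbb{F}_{2^{3m}})^2$. For $\alpha\in\mathbb{F}_{2^m}\setminus\{1\}$ and $i\in\{0,1,2,3\}$ let \[n_i(\alpha)=\#\{P_\mu : \mu\in\mathbb{F}_{2^{3m}},\ \mathrm{N}_{2^{3m}/2^m}(\mu)=\alpha,\ \dim_{\mathbb{F}_2}(P_\mu\cap U_s)=i\}.\] Then $n_0(\alpha)=2n_2(\alpha)+6n_3(\alpha)$.
   Context: $\mathrm{N}_{2^{3m}/2^m}(\mu)=\mu^{2^{2m}+2^m+1}$. $U_s$ and $P_\mu$ are considered as $\mathbb{F}_2$-subspaces of $(\mathbb{F}_{2^{3m}})^2$. -}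

module Defs where

open import Level using (0ℓ)
open import Data.Nat using (ℕ; zero; suc; _+_; _*_; _^_)
open import Data.Fin using (Fin)
open import Data.Bool using (Bool; true; false; if_then_else_)
open import Data.Product using (Σ; ∃; _×_; _,_; proj₁; proj₂)
open import Relation.Binary.PropositionalEquality using (_≡_)
open import Relation.Nullary using (¬_)
open import Algebra.Structures using (IsCommutativeRing)
open import Function.Bundles using (_↔_)

record FiniteField2 (n : ℕ) : Set₁ where
  infixl 6 _+F_
  infixl 7 _*F_
  field
    F     : Set
    _+F_  : F → F → F
    _*F_  : F → F → F
    -F_   : F → F
    0F 1F : F
    isCommutativeRing : IsCommutativeRing _≡_ _+F_ _*F_ -F_ 0F 1F
    inverse  : ∀ x → ¬ (x ≡ 0F) → Σ F λ y → x *F y ≡ 1F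
    nontrivial : ¬ (1F ≡ 0F)
    char2    : 1F +F 1F ≡ 0F
    card     : Fin (2 ^ n) ↔ F

  _^F_ : F → ℕ → F
  x ^F zero    = 1F
  x ^F (suc k) = x *F (x ^F k)

  F² : Set
  F² = F × F

  _+²_ : F² → F² → F²
  (a , b) +² (c , d) = (a +F c , b +F d)

  0² : F²
  0² = (0F , 0F)

module _ {n : ℕ} (𝔽 : FiniteField2 n) where
  open FiniteField2 𝔽

  -- F_2-linear combination Σ_j c_j v_j with coefficients c_j ∈ F_2 = Bool
  lincomb : (i : ℕ) → (Fin i → Bool) → (Fin i → F²) → F²
  lincomb zero    c v = 0²
  lincomb (suc i) c v =
    (if c Fin.zero then v Fin.zero else 0²) +² lincomb i (λ j → c (Fin.suc j)) (λ j → v (Fin.suc j))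
    where import Data.Fin as Fin

  HasDimF2 : (F² → Set) → ℕ → Set
  HasDimF2 W i = Σ (Fin i → F²) λ v →
      (∀ j → W (v j))
    × (∀ (c : Fin i → Bool) → lincomb i c v ≡ 0² → ∀ j → c j ≡ false)
    × (∀ w → W w → Σ (Fin i → Bool) λ c → lincomb i c v ≡ w)

module _ (m : ℕ) (𝔽 : FiniteField2 (3 * m)) where
  open FiniteField2 𝔽

  Norm : F → F
  Norm μ = μ ^F (2 ^ (2 * m) + 2 ^ m + 1)

  InSubfield : F → Set
  InSubfield α = α ^F (2 ^ m) ≡ α

  U : ℕ → F² → Set
  U s w = ∃ λ x → w ≡ (x ^F (2 ^ s) , (x ^F (2 ^ (m + s))) +F x)

  P : F → F² → Set
  P μ w = ∃ λ l → w ≡ (l , l *F μ)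

  PU : ℕ → F → F² → Set
  PU s μ w = P μ w × U s w

  -- the set of μ with N(μ) = α and dim_{F_2}(P_μ ∩ U_s) = i, where
  -- dim : F → ℕ is the dimension function μ ↦ dim_{F_2}(P_μ ∩ U_s)
  -- (supplied together with a proof that it is the dimension).
  -- (μ ↦ P_μ is injective, so counting these μ counts the planes P_μ)
  Nset : (F → ℕ) → F → ℕ → Set
  Nset dim α i = Σ F λ μ → (Norm μ ≡ α) × (dim μ ≡ i)

-- Write k = m + s. The point (x^{2^s}, x^{2^k} + x) of U_s lies on P_μ iff x^{2^k} + x = μ x^{2^s},
-- an F₂-linear condition on x, so P_μ ∩ U_s has 2^{dim} − 1 nonzero points, each of which determines
-- μ = (x^{2^k} + x) / x^{2^s}. Since N(x^{2^k}) = N(x^{2^s}), that μ has the norm of 1 + x^{1 − 2^k},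
-- and x ↦ x^{1 − 2^k} is injective because gcd(k, 3m) = 1 makes F₂ the fixed field of x ↦ x^{2^k}.
-- Counting the pairs (μ, x ≠ 0) with N(μ) = α both ways (x = 0 would give N = 1 ≠ α) yields
-- n₁ + 3n₂ + 7n₃ = n₀ + n₁ + n₂ + n₃. The dimension is at most 3 because the conjugates
-- (x, x^{2^m}, x^{2^{2m}}) of such x solve a Frobenius-twisted 3 × 3 linear system, whose
-- F₂-independent solutions are F-independent.

module Submission where

open import Defs
import Algebra.Properties.CommutativeMonoid.Sum as MonoidSum
import Algebra.Properties.CommutativeSemiring.Exp as SemiringExp
import Algebra.Properties.Semiring.Sum as SemiringSum
import Algebra.Solver.Ring.NaturalCoefficients.Default as RingSolver
import Axiom.UniquenessOfIdentityProofs as UIP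
import Data.Fin.Properties as FinP
import Data.Nat.Properties as ℕP
import Data.Vec.Functional.Properties as VecP
open import Algebra.Bundles using (CommutativeMonoid; CommutativeRing)
open import Algebra.Structures using (IsCommutativeMonoid; IsCommutativeRing)
open import Data.Bool using (Bool; true; false; if_then_else_; _xor_)
open import Data.Empty using (⊥-elim)
open import Data.Fin as Fin using (Fin; zero; suc; punchIn; punchOut)
open import Data.Fin.Permutation using (Permutation; ↔⇒≡)
open import Data.Nat as ℕ using (ℕ; z≤n; s≤s)
open import Data.Nat.GCD using (gcd; gcd-GCD; GCD; module Bézout)
open import Data.Nat.Tactic.RingSolver using () renaming (solve-∀ to ℕ-ring-solve)
open import Data.Product using (Σ; ∃; _×_; _,_; proj₁; proj₂)
open import Data.Product.Function.Dependent.Propositional using () renaming (cong to Σ-cong)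
open import Data.Product.Properties using (Σ-≡,≡→≡)
open import Data.Sum using (_⊎_; inj₁; inj₂)
open import Data.Sum.Function.Propositional using (_⊎-↔_)
open import Data.Vec.Functional using (insertAt; replicate)
open import Function using (_∘_)
open import Function.Bundles using (_↔_; Inverse; Injection; mk↔ₛ′)
open import Function.Construct.Identity using (↔-id)
open import Function.Definitions using (Injective)
open import Function.Properties.Inverse using (↔⇒↣; ↔-sym; ↔-trans)
open import Level using (0ℓ)
open import Relation.Binary.PropositionalEquality
open import Relation.Nullary using (¬_; Dec; yes; no; does; ¬?)
open import Relation.Nullary.Decidable using (decidable-stable; _×-dec_)

-- Finite sums and counting

Fin-injective⇒surjective : ∀ {k} {f : Fin k → Fin k} → Injective _≡_ _≡_ f → ∀ y → ∃ λ x → f x ≡ y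
Fin-injective⇒surjective {ℕ.suc k} {f} f-inj y with FinP.any? (λ x → f x Fin.≟ y)
... | yes hit = hit
... | no miss = ⊥-elim (ℕP.<-irrefl refl (FinP.injective⇒≤ punchOut∘f-injective))
  where
  y≢f : ∀ x → y ≢ f x
  y≢f x eq = miss (x , sym eq)
  punchOut∘f-injective : Injective _≡_ _≡_ (λ x → punchOut (y≢f x))
  punchOut∘f-injective eq = f-inj (FinP.punchOut-injective (y≢f _) (y≢f _) eq)

injective⇒permutation : ∀ {k} (f : Fin k → Fin k) → Injective _≡_ _≡_ f → Permutation k k
injective⇒permutation f f-inj = mk↔ₛ′ f (proj₁ ∘ onto) (proj₂ ∘ onto) (λ x → f-inj (proj₂ (onto (f x))))
  where onto = Fin-injective⇒surjective f-inj

funToFin-cong : ∀ {k l} {f g : Fin k → Fin l} → f ≗ g → Fin.funToFin f ≡ Fin.funToFin g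
funToFin-cong {ℕ.zero}  f≗g = refl
funToFin-cong {ℕ.suc k} f≗g = cong₂ Fin.combine (f≗g zero) (funToFin-cong (f≗g ∘ suc))

finToFun-injective : ∀ {k l} {i j : Fin (l ℕ.^ k)} → Fin.finToFun {l} {k} i ≗ Fin.finToFun j → i ≡ j
finToFun-injective {k} {l} {i} {j} eq =
  trans (sym (FinP.funToFin-finToFin {k} i)) (trans (funToFin-cong eq) (FinP.funToFin-finToFin {k} j))

card≡2^ : ∀ {N d} {A : Set} → Fin N ↔ A →
          (f : A → Fin d → Bool) → (∀ {a b} → f a ≗ f b → a ≡ b) →
          (g : (Fin d → Bool) → A) → (∀ {c c′} → g c ≡ g c′ → c ≗ c′) → N ≡ 2 ℕ.^ d
card≡2^ {N} {d} enum f f-inj g g-inj = FinP.cantor-schröder-bernstein {f = encode} {g = decode} encode-injective decode-injective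
  where
  open Inverse FinP.2↔Bool using () renaming (to to toBool; from to fromBool)
  toBool-injective : Injective _≡_ _≡_ toBool
  toBool-injective = Injection.injective (↔⇒↣ FinP.2↔Bool)
  fromBool-injective : Injective _≡_ _≡_ fromBool
  fromBool-injective = Injection.injective (↔⇒↣ (↔-sym FinP.2↔Bool))
  encode : Fin N → Fin (2 ℕ.^ d)
  encode i = Fin.funToFin (fromBool ∘ f (Inverse.to enum i))
  decode : Fin (2 ℕ.^ d) → Fin N
  decode i = Inverse.from enum (g (toBool ∘ Fin.finToFun i))
  encode-injective : Injective _≡_ _≡_ encode
  encode-injective {i} {j} eq = Injection.injective (↔⇒↣ enum) (f-inj (λ l → fromBool-injective
    (trans (sym (FinP.finToFun-funToFin _ l)) (trans (cong (λ x → Fin.finToFun x l) eq) (FinP.finToFun-funToFin _ l)))))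
  decode-injective : Injective _≡_ _≡_ decode
  decode-injective eq = finToFun-injective (toBool-injective ∘ g-inj (Injection.injective (↔⇒↣ (↔-sym enum)) eq))

module FiniteSum {A : Set} {N : ℕ} (enum : Fin N ↔ A)
                 {M : Set} {_∙_ : M → M → M} {ε : M} (isCM : IsCommutativeMonoid _≡_ _∙_ ε) where
  private
    monoid : CommutativeMonoid 0ℓ 0ℓ
    monoid = record { isCommutativeMonoid = isCM }
    module S = MonoidSum monoid
    open IsCommutativeMonoid isCM using (identityʳ)
    open Inverse enum using (to; from; strictlyInverseˡ; strictlyInverseʳ)
    to-injective : Injective _≡_ _≡_ to
    to-injective = Injection.injective (↔⇒↣ enum)
    from-injective : Injective _≡_ _≡_ from
    from-injective = Injection.injective (↔⇒↣ (↔-sym enum))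

  open import Algebra.Definitions.RawMonoid (CommutativeMonoid.rawMonoid monoid) public using () renaming (_×_ to _×ₘ_)

  ∑ : (A → M) → M
  ∑ f = S.sum (f ∘ to)

  ∑-cong : ∀ {f g} → (∀ a → f a ≡ g a) → ∑ f ≡ ∑ g
  ∑-cong eq = S.sum-cong-≗ (eq ∘ to)

  ∑-distrib : ∀ f g → ∑ (λ a → f a ∙ g a) ≡ ∑ f ∙ ∑ g
  ∑-distrib f g = S.∑-distrib-+ (f ∘ to) (g ∘ to)

  ∑-comm : ∀ (f : A → A → M) → ∑ (λ a → ∑ (f a)) ≡ ∑ (λ b → ∑ (λ a → f a b))
  ∑-comm f = S.∑-comm (λ i j → f (to i) (to j))

  ∑-const : ∀ c → ∑ (λ _ → c) ≡ N ×ₘ c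
  ∑-const c = S.sum-replicate N

  ∑-closed : (P : M → Set) → P ε → (∀ {x y} → P x → P y → P (x ∙ y)) → ∀ f → (∀ a → P (f a)) → P (∑ f)
  ∑-closed P Pε P∙ f Pf = sum-closed (f ∘ to) (Pf ∘ to)
    where
    sum-closed : ∀ {k} (t : Fin k → M) → (∀ i → P (t i)) → P (S.sum t)
    sum-closed {ℕ.zero} t Pt = Pε
    sum-closed {ℕ.suc k} t Pt = P∙ (Pt zero) (sum-closed (t ∘ suc) (Pt ∘ suc))

  ∑-single : ∀ f a → (∀ b → b ≢ a → f b ≡ ε) → ∑ f ≡ f a
  ∑-single f a rest = trans (sum-single (f ∘ to) (from a) (λ i i≢ → rest (to i) (i≢ ∘ to≡⇒≡from)))
                            (cong f (strictlyInverseˡ a))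
    where
    to≡⇒≡from : ∀ {i} → to i ≡ a → i ≡ from a
    to≡⇒≡from {i} eq = trans (sym (strictlyInverseʳ i)) (cong from eq)
    sum-single : ∀ {k} (t : Fin k → M) i → (∀ j → j ≢ i → t j ≡ ε) → S.sum t ≡ t i
    sum-single {ℕ.suc k} t i rest′ = begin
      S.sum t                                 ≡⟨ S.sum-remove t ⟩
      t i ∙ S.sum (t ∘ punchIn i)             ≡⟨ cong (t i ∙_) (S.sum-cong-≗ (λ j → rest′ (punchIn i j) (FinP.punchInᵢ≢i i j))) ⟩
      t i ∙ S.sum (replicate k ε)             ≡⟨ cong (t i ∙_) (S.sum-replicate-zero k) ⟩
      t i ∙ ε                                 ≡⟨ identityʳ (t i) ⟩
      t i                                     ∎
      where open ≡-Reasoning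

  ∑-reindex : ∀ {g : A → A} → Injective _≡_ _≡_ g → ∀ f → ∑ (f ∘ g) ≡ ∑ f
  ∑-reindex {g} g-inj f =
    sym (trans (S.∑-permute (f ∘ to) π) (∑-cong (λ a → cong f (strictlyInverseˡ (g a)))))
    where
    π : Permutation N N
    π = injective⇒permutation (from ∘ g ∘ to) (to-injective ∘ g-inj ∘ from-injective)

χ : ∀ {P : Set} → Dec P → ℕ
χ (yes _) = 1
χ (no _)  = 0

χ↔ : ∀ {P : Set} (P? : Dec P) → (∀ (p q : P) → p ≡ q) → Fin (χ P?) ↔ P
χ↔ (yes p) irr = mk↔ₛ′ (λ _ → p) (λ _ → zero) (irr p) (λ { zero → refl ; (suc ()) })
χ↔ (no ¬p) irr = mk↔ₛ′ (λ ()) (⊥-elim ∘ ¬p) (⊥-elim ∘ ¬p) (λ ())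

χ-cong : ∀ {P Q : Set} (P? : Dec P) (Q? : Dec Q) → (P → Q) → (Q → P) → χ P? ≡ χ Q?
χ-cong (yes _) (yes _) _   _   = refl
χ-cong (yes p) (no ¬q) P→Q _   = ⊥-elim (¬q (P→Q p))
χ-cong (no ¬p) (yes q) _   Q→P = ⊥-elim (¬p (Q→P q))
χ-cong (no _)  (no _)  _   _   = refl

χ-≡0 : ∀ {P : Set} (P? : Dec P) → ¬ P → χ P? ≡ 0
χ-≡0 (yes p) ¬p = ⊥-elim (¬p p)
χ-≡0 (no _)  _  = refl

Σ-Fin-suc↔ : ∀ {k} (P : Fin (ℕ.suc k) → Set) → (P zero ⊎ Σ (Fin k) (P ∘ suc)) ↔ Σ (Fin (ℕ.suc k)) P
Σ-Fin-suc↔ P = mk↔ₛ′ join split join∘split split∘join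
  where
  join : P zero ⊎ Σ _ (P ∘ suc) → Σ _ P
  join (inj₁ p)       = zero , p
  join (inj₂ (i , p)) = suc i , p
  split : Σ _ P → P zero ⊎ Σ _ (P ∘ suc)
  split (zero , p)  = inj₁ p
  split (suc i , p) = inj₂ (i , p)
  join∘split : ∀ x → join (split x) ≡ x
  join∘split (zero , p)  = refl
  join∘split (suc i , p) = refl
  split∘join : ∀ x → split (join x) ≡ x
  split∘join (inj₁ p)       = refl
  split∘join (inj₂ (i , p)) = refl

module Count {A : Set} {N : ℕ} (enum : Fin N ↔ A) where
  open FiniteSum enum ℕP.+-0-isCommutativeMonoid public

  ∑-scale : ∀ c f → ∑ (λ a → c ℕ.* f a) ≡ c ℕ.* ∑ f
  ∑-scale c f = sym (SemiringSum.*-distribˡ-sum ℕP.+-*-semiring c (f ∘ Inverse.to enum))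

  module _ (_≟ₐ_ : (a b : A) → Dec (a ≡ b)) where

    ∑-δ : ∀ a (g : A → ℕ) → ∑ (λ b → χ (a ≟ₐ b) ℕ.* g b) ≡ g a
    ∑-δ a g = trans (∑-single (λ b → χ (a ≟ₐ b) ℕ.* g b) a off-diagonal) (on-diagonal (a ≟ₐ a))
      where
      off-diagonal : ∀ b → b ≢ a → χ (a ≟ₐ b) ℕ.* g b ≡ 0
      off-diagonal b b≢a with a ≟ₐ b
      ... | yes a≡b = ⊥-elim (b≢a (sym a≡b))
      ... | no _    = refl
      on-diagonal : (a≟a : Dec (a ≡ a)) → χ a≟a ℕ.* g a ≡ g a
      on-diagonal (yes _)   = ℕP.+-identityʳ (g a)
      on-diagonal (no a≢a) = ⊥-elim (a≢a refl)

    ∑-fibres : ∀ (w : A → ℕ) (h : A → A) (g : A → ℕ) →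
               ∑ (λ a → w a ℕ.* g (h a)) ≡ ∑ (λ b → g b ℕ.* ∑ (λ a → w a ℕ.* χ (h a ≟ₐ b)))
    ∑-fibres w h g = begin
      ∑ (λ a → w a ℕ.* g (h a))
        ≡⟨ ∑-cong (λ a → cong (w a ℕ.*_) (sym (∑-δ (h a) g))) ⟩
      ∑ (λ a → w a ℕ.* ∑ (λ b → χ (h a ≟ₐ b) ℕ.* g b))
        ≡⟨ ∑-cong (λ a → sym (∑-scale (w a) (λ b → χ (h a ≟ₐ b) ℕ.* g b))) ⟩
      ∑ (λ a → ∑ (λ b → w a ℕ.* (χ (h a ≟ₐ b) ℕ.* g b)))
        ≡⟨ ∑-comm (λ a b → w a ℕ.* (χ (h a ≟ₐ b) ℕ.* g b)) ⟩
      ∑ (λ b → ∑ (λ a → w a ℕ.* (χ (h a ≟ₐ b) ℕ.* g b)))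
        ≡⟨ ∑-cong (λ b → trans (∑-cong (λ a → rearrange (w a) (χ (h a ≟ₐ b)) (g b)))
                               (∑-scale (g b) (λ a → w a ℕ.* χ (h a ≟ₐ b)))) ⟩
      ∑ (λ b → g b ℕ.* ∑ (λ a → w a ℕ.* χ (h a ≟ₐ b)))
        ∎
      where
      open ≡-Reasoning
      rearrange : ∀ x y z → x ℕ.* (y ℕ.* z) ≡ z ℕ.* (x ℕ.* y)
      rearrange x y z = trans (sym (ℕP.*-assoc x y z)) (ℕP.*-comm (x ℕ.* y) z)

  count↔ : ∀ {P : A → Set} (P? : ∀ a → Dec (P a)) → (∀ {a} (p q : P a) → p ≡ q) → Fin (∑ (χ ∘ P?)) ↔ Σ A P
  count↔ {P} P? irr = ↔-trans (count-Fin (P? ∘ Inverse.to enum) irr) (Σ-cong enum (↔-id _))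
    where
    count-Fin : ∀ {k} {Q : Fin k → Set} (Q? : ∀ i → Dec (Q i)) → (∀ {i} (p q : Q i) → p ≡ q) →
                Fin (MonoidSum.sum ℕP.+-0-commutativeMonoid (χ ∘ Q?)) ↔ Σ (Fin k) Q
    count-Fin {ℕ.zero}  Q? _ = mk↔ₛ′ (λ ()) (λ { (() , _) }) (λ { (() , _) }) (λ ())
    count-Fin {ℕ.suc k} {Q} Q? irr′ =
      ↔-trans FinP.+↔⊎ (↔-trans (χ↔ (Q? zero) irr′ ⊎-↔ count-Fin (Q? ∘ suc) irr′) (Σ-Fin-suc↔ Q))

+1-injective : ∀ {c t} → c ℕ.+ 1 ≡ ℕ.suc t → c ≡ t
+1-injective {c} eq = ℕP.suc-injective (trans (ℕP.+-comm 1 c) eq)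

χ-by-value : ∀ {P : Set} (P? : Dec P) d → d ℕ.≤ 3 →
             χ P? ≡ χ (P? ×-dec d ℕ.≟ 0) ℕ.+ χ (P? ×-dec d ℕ.≟ 1) ℕ.+ χ (P? ×-dec d ℕ.≟ 2) ℕ.+ χ (P? ×-dec d ℕ.≟ 3)
χ-by-value (no _)  _ _                         = refl
χ-by-value (yes _) 0 _                         = refl
χ-by-value (yes _) 1 _                         = refl
χ-by-value (yes _) 2 _                         = refl
χ-by-value (yes _) 3 _                         = refl
χ-by-value (yes _) (ℕ.suc (ℕ.suc (ℕ.suc (ℕ.suc _)))) (s≤s (s≤s (s≤s ())))

χ-weighted : ∀ {P : Set} (P? : Dec P) d c → d ℕ.≤ 3 → c ℕ.+ 1 ≡ 2 ℕ.^ d →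
             χ P? ℕ.* c ≡ χ (P? ×-dec d ℕ.≟ 1) ℕ.+ 3 ℕ.* χ (P? ×-dec d ℕ.≟ 2) ℕ.+ 7 ℕ.* χ (P? ×-dec d ℕ.≟ 3)
χ-weighted (no _)  _ _ _ _ = refl
χ-weighted (yes _) 0 c _ c+1≡1 rewrite +1-injective {c} c+1≡1 = refl
χ-weighted (yes _) 1 c _ c+1≡2 rewrite +1-injective {c} c+1≡2 = refl
χ-weighted (yes _) 2 c _ c+1≡4 rewrite +1-injective {c} c+1≡4 = refl
χ-weighted (yes _) 3 c _ c+1≡8 rewrite +1-injective {c} c+1≡8 = refl
χ-weighted (yes _) (ℕ.suc (ℕ.suc (ℕ.suc (ℕ.suc _)))) _ (s≤s (s≤s (s≤s ()))) _

cancel-count : ∀ {a b c d} → a ℕ.+ b ℕ.+ c ℕ.+ d ≡ b ℕ.+ 3 ℕ.* c ℕ.+ 7 ℕ.* d → a ≡ 2 ℕ.* c ℕ.+ 6 ℕ.* d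
cancel-count {a} {b} {c} {d} eq = ℕP.+-cancelʳ-≡ (b ℕ.+ c ℕ.+ d) a (2 ℕ.* c ℕ.+ 6 ℕ.* d)
  (trans (regroupˡ a b c d) (trans eq (regroupʳ b c d)))
  where
  regroupˡ : ∀ a b c d → a ℕ.+ (b ℕ.+ c ℕ.+ d) ≡ a ℕ.+ b ℕ.+ c ℕ.+ d
  regroupˡ = ℕ-ring-solve
  regroupʳ : ∀ b c d → b ℕ.+ 3 ℕ.* c ℕ.+ 7 ℕ.* d ≡ 2 ℕ.* c ℕ.+ 6 ℕ.* d ℕ.+ (b ℕ.+ c ℕ.+ d)
  regroupʳ = ℕ-ring-solve

-- Finite fields of characteristic 2

module Char2Field {n : ℕ} (𝔽 : FiniteField2 n) where
  open FiniteField2 𝔽 public using (F)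
  open FiniteField2 𝔽 using (isCommutativeRing; inverse; nontrivial; char2; card)

  ring : CommutativeRing 0ℓ 0ℓ
  ring = record { isCommutativeRing = isCommutativeRing }

  open CommutativeRing ring public
    using (_+_; _*_; 0#; 1#; +-comm; +-assoc; +-identityˡ; +-identityʳ; *-comm; *-assoc;
           *-identityˡ; *-identityʳ; zeroˡ; zeroʳ; distribˡ; distribʳ)
  open SemiringExp (CommutativeRing.commutativeSemiring ring) public
    using (_^_; ^-homo-*; ^-assocʳ; ^-distrib-*)
  open RingSolver (CommutativeRing.commutativeSemiring ring) public using (solve; _:=_; _:+_; _:*_; con)
  open ≡-Reasoning

  x+x≡0 : ∀ x → x + x ≡ 0#
  x+x≡0 x = begin
    x + x               ≡⟨ sym (cong₂ _+_ (*-identityˡ x) (*-identityˡ x)) ⟩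
    1# * x + 1# * x     ≡⟨ sym (distribʳ x 1# 1#) ⟩
    (1# + 1#) * x       ≡⟨ cong (_* x) char2 ⟩
    0# * x              ≡⟨ zeroˡ x ⟩
    0#                  ∎

  ≡⇒+≡0 : ∀ {a b} → a ≡ b → a + b ≡ 0#
  ≡⇒+≡0 {a} refl = x+x≡0 a

  a+[a+x]≡x : ∀ a x → a + (a + x) ≡ x
  a+[a+x]≡x a x = trans (sym (+-assoc a a x)) (trans (cong (_+ x) (x+x≡0 a)) (+-identityˡ x))

  +≡0⇒≡ : ∀ {a b} → a + b ≡ 0# → a ≡ b
  +≡0⇒≡ {a} {b} a+b≡0 = sym (trans (sym (a+[a+x]≡x a b)) (trans (cong (a +_) a+b≡0) (+-identityʳ a)))

  +-interchange : ∀ a b c d → (a + b) + (c + d) ≡ (a + c) + (b + d)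
  +-interchange = solve 4 (λ a b c d → (a :+ b) :+ (c :+ d) := (a :+ c) :+ (b :+ d)) refl

  +-cancelˡ : ∀ a {x y} → a + x ≡ a + y → x ≡ y
  +-cancelˡ a {x} {y} eq = trans (sym (a+[a+x]≡x a x)) (trans (cong (a +_) eq) (a+[a+x]≡x a y))

  infix 4 _≟_
  _≟_ : (x y : F) → Dec (x ≡ y)
  x ≟ y with Inverse.from card x Fin.≟ Inverse.from card y
  ... | yes eq = yes (Injection.injective (↔⇒↣ (↔-sym card)) eq)
  ... | no neq = no (neq ∘ cong (Inverse.from card))


  ≡-irrelevant : ∀ {x y : F} (p q : x ≡ y) → p ≡ q
  ≡-irrelevant = UIP-F.≡-irrelevant
    where module UIP-F = UIP.Decidable⇒UIP _≟_

  1≢0 : 1# ≢ 0#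
  1≢0 = nontrivial

  _⁻¹ : F → F
  x ⁻¹ with x ≟ 0#
  ... | yes _   = 0#
  ... | no x≢0 = proj₁ (inverse x x≢0)

  ⁻¹-inverseʳ : ∀ {x} → x ≢ 0# → x * x ⁻¹ ≡ 1#
  ⁻¹-inverseʳ {x} x≢0 with x ≟ 0#
  ... | yes x≡0  = ⊥-elim (x≢0 x≡0)
  ... | no x≢0′ = proj₂ (inverse x x≢0′)

  ⁻¹-inverseˡ : ∀ {x} → x ≢ 0# → x ⁻¹ * x ≡ 1#
  ⁻¹-inverseˡ {x} x≢0 = trans (*-comm (x ⁻¹) x) (⁻¹-inverseʳ x≢0)

  *-*⁻¹-cancel : ∀ {b} a → b ≢ 0# → a * b * b ⁻¹ ≡ a
  *-*⁻¹-cancel {b} a b≢0 = trans (*-assoc a b (b ⁻¹)) (trans (cong (a *_) (⁻¹-inverseʳ b≢0)) (*-identityʳ a))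

  *⁻¹-*-cancel : ∀ {b} a → b ≢ 0# → a * b ⁻¹ * b ≡ a
  *⁻¹-*-cancel {b} a b≢0 = trans (*-assoc a (b ⁻¹) b) (trans (cong (a *_) (⁻¹-inverseˡ b≢0)) (*-identityʳ a))

  *-cancelʳ : ∀ {a b c} → c ≢ 0# → a * c ≡ b * c → a ≡ b
  *-cancelʳ {a} {b} {c} c≢0 eq = trans (sym (*-*⁻¹-cancel a c≢0)) (trans (cong (_* c ⁻¹) eq) (*-*⁻¹-cancel b c≢0))

  *-cancelˡ : ∀ {c} → c ≢ 0# → Injective _≡_ _≡_ (c *_)
  *-cancelˡ {c} c≢0 {a} {b} eq = *-cancelʳ c≢0 (trans (*-comm a c) (trans eq (*-comm c b)))

  ⁻¹-unique : ∀ {x y} → x * y ≡ 1# → y ≡ x ⁻¹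
  ⁻¹-unique {x} {y} xy≡1 = *-cancelʳ x≢0 (trans (*-comm y x) (trans xy≡1 (sym (⁻¹-inverseˡ x≢0))))
    where
    x≢0 : x ≢ 0#
    x≢0 x≡0 = 1≢0 (trans (sym xy≡1) (trans (cong (_* y) x≡0) (zeroˡ y)))

  *-≢0 : ∀ {x y} → x ≢ 0# → y ≢ 0# → x * y ≢ 0#
  *-≢0 {x} {y} x≢0 y≢0 xy≡0 = y≢0 (begin
    y                   ≡⟨ sym (*-identityˡ y) ⟩
    1# * y              ≡⟨ cong (_* y) (sym (⁻¹-inverseˡ x≢0)) ⟩
    x ⁻¹ * x * y        ≡⟨ *-assoc (x ⁻¹) x y ⟩
    x ⁻¹ * (x * y)      ≡⟨ cong (x ⁻¹ *_) xy≡0 ⟩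
    x ⁻¹ * 0#           ≡⟨ zeroʳ (x ⁻¹) ⟩
    0#                  ∎)

  ⁻¹-≢0 : ∀ {x} → x ≢ 0# → x ⁻¹ ≢ 0#
  ⁻¹-≢0 {x} x≢0 x⁻¹≡0 = 1≢0 (trans (sym (⁻¹-inverseʳ x≢0)) (trans (cong (x *_) x⁻¹≡0) (zeroʳ x)))

  homomorphism-⁻¹ : ∀ (h : F → F) → h 1# ≡ 1# → (∀ x y → h (x * y) ≡ h x * h y) →
                    ∀ {x} → x ≢ 0# → h (x ⁻¹) ≡ h x ⁻¹
  homomorphism-⁻¹ h h1≡1 h-* {x} x≢0 =
    ⁻¹-unique (trans (sym (h-* x (x ⁻¹))) (trans (cong h (⁻¹-inverseʳ x≢0)) h1≡1))

  1^k≡1 : ∀ k → 1# ^ k ≡ 1#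
  1^k≡1 ℕ.zero    = refl
  1^k≡1 (ℕ.suc k) = trans (*-identityˡ _) (1^k≡1 k)

  ^-≢0 : ∀ {x} k → x ≢ 0# → x ^ k ≢ 0#
  ^-≢0 ℕ.zero    x≢0 = 1≢0
  ^-≢0 (ℕ.suc k) x≢0 = *-≢0 x≢0 (^-≢0 k x≢0)

  ^F≡^ : ∀ x k → FiniteField2._^F_ 𝔽 x k ≡ x ^ k
  ^F≡^ x ℕ.zero    = refl
  ^F≡^ x (ℕ.suc k) = cong (x *_) (^F≡^ x k)

  frob : ℕ → F → F
  frob a x = x ^ (2 ℕ.^ a)

  [x+y]²≡x²+y² : ∀ x y → (x + y) ^ 2 ≡ x ^ 2 + y ^ 2
  [x+y]²≡x²+y² x y = begin
    (x + y) ^ 2                                     ≡⟨ expand x y 1# ⟩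
    (x ^ 2 + y ^ 2) + (x * y * 1# + x * y * 1#)     ≡⟨ cong (x ^ 2 + y ^ 2 +_) (x+x≡0 _) ⟩
    (x ^ 2 + y ^ 2) + 0#                            ≡⟨ +-identityʳ _ ⟩
    x ^ 2 + y ^ 2                                   ∎
    where
    expand : ∀ x y o → (x + y) * ((x + y) * o) ≡ (x * (x * o) + y * (y * o)) + (x * y * o + x * y * o)
    expand = solve 3 (λ x y o → (x :+ y) :* ((x :+ y) :* o) := (x :* (x :* o) :+ y :* (y :* o)) :+ (x :* y :* o :+ x :* y :* o)) refl

  frob-suc : ∀ a x → frob (ℕ.suc a) x ≡ frob a (x ^ 2)
  frob-suc a x = sym (^-assocʳ x 2 (2 ℕ.^ a))

  frob-+ : ∀ a x y → frob a (x + y) ≡ frob a x + frob a y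
  frob-+ ℕ.zero    x y = trans (*-identityʳ _) (sym (cong₂ _+_ (*-identityʳ x) (*-identityʳ y)))
  frob-+ (ℕ.suc a) x y = begin
    frob (ℕ.suc a) (x + y)            ≡⟨ frob-suc a (x + y) ⟩
    frob a ((x + y) ^ 2)              ≡⟨ cong (frob a) ([x+y]²≡x²+y² x y) ⟩
    frob a (x ^ 2 + y ^ 2)            ≡⟨ frob-+ a (x ^ 2) (y ^ 2) ⟩
    frob a (x ^ 2) + frob a (y ^ 2)   ≡⟨ sym (cong₂ _+_ (frob-suc a x) (frob-suc a y)) ⟩
    frob (ℕ.suc a) x + frob (ℕ.suc a) y ∎

  frob-* : ∀ a x y → frob a (x * y) ≡ frob a x * frob a y
  frob-* a x y = ^-distrib-* x y (2 ℕ.^ a)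

  frob-1 : ∀ a → frob a 1# ≡ 1#
  frob-1 a = 1^k≡1 (2 ℕ.^ a)

  frob-0 : ∀ a → frob a 0# ≡ 0#
  frob-0 a = trans (cong (frob a) (sym (+-identityˡ 0#))) (trans (frob-+ a 0# 0#) (x+x≡0 _))

  frob-∘ : ∀ a b x → frob a (frob b x) ≡ frob (b ℕ.+ a) x
  frob-∘ a b x = trans (^-assocʳ x (2 ℕ.^ b) (2 ℕ.^ a)) (cong (x ^_) (sym (ℕP.^-distribˡ-+-* 2 b a)))

  frob-comm : ∀ a b x → frob a (frob b x) ≡ frob b (frob a x)
  frob-comm a b x = trans (frob-∘ a b x) (trans (cong (λ c → frob c x) (ℕP.+-comm b a)) (sym (frob-∘ b a x)))

  frob-≢0 : ∀ a {x} → x ≢ 0# → frob a x ≢ 0#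
  frob-≢0 a = ^-≢0 (2 ℕ.^ a)

  frob-injective : ∀ a {x y} → frob a x ≡ frob a y → x ≡ y
  frob-injective a {x} {y} eq with x + y ≟ 0#
  ... | yes x+y≡0 = +≡0⇒≡ x+y≡0
  ... | no x+y≢0 = ⊥-elim (frob-≢0 a x+y≢0 (trans (frob-+ a x y) (≡⇒+≡0 eq)))

  frob-⁻¹ : ∀ a {x} → x ≢ 0# → frob a (x ⁻¹) ≡ frob a x ⁻¹
  frob-⁻¹ a = homomorphism-⁻¹ (frob a) (frob-1 a) (frob-* a)

  module ∏ = FiniteSum card (IsCommutativeRing.*-isCommutativeMonoid isCommutativeRing)

  -- y ↦ x y permutes F for x ≠ 0; comparing ∏ unit (x y) with ∏ x · unit y gives x^{2^n} = x
  -- (unit replaces 0 by 1 so that the product is invertible, defect compensates at y = 0).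
  fermat : ∀ x → frob n x ≡ x
  fermat x with x ≟ 0#
  ... | yes refl = frob-0 n
  ... | no x≢0  = *-cancelʳ (∏.∑-closed (_≢ 0#) 1≢0 *-≢0 unit unit≢0) key
    where
    unit : F → F
    unit y with y ≟ 0#
    ... | yes _ = 1#
    ... | no _  = y
    defect : F → F
    defect y with y ≟ 0#
    ... | yes _ = x
    ... | no _  = 1#
    unit≢0 : ∀ y → unit y ≢ 0#
    unit≢0 y with y ≟ 0#
    ... | yes _   = 1≢0
    ... | no y≢0 = y≢0
    shift : ∀ y → x * unit y ≡ unit (x * y) * defect y
    shift y with y ≟ 0# | x * y ≟ 0#
    ... | yes _   | yes _    = trans (*-identityʳ x) (sym (*-identityˡ x))
    ... | yes y≡0 | no xy≢0 = ⊥-elim (xy≢0 (trans (cong (x *_) y≡0) (zeroʳ x)))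
    ... | no y≢0  | yes xy≡0 = ⊥-elim (*-≢0 x≢0 y≢0 xy≡0)
    ... | no _    | no _     = sym (*-identityʳ _)
    ∏defect≡x : ∏.∑ defect ≡ x
    ∏defect≡x = trans (∏.∑-single defect 0# away) defect-0
      where
      defect-0 : defect 0# ≡ x
      defect-0 with 0# ≟ 0#
      ... | yes _   = refl
      ... | no 0≢0 = ⊥-elim (0≢0 refl)
      away : ∀ y → y ≢ 0# → defect y ≡ 1#
      away y y≢0 with y ≟ 0#
      ... | yes y≡0 = ⊥-elim (y≢0 y≡0)
      ... | no _    = refl
    key : frob n x * ∏.∑ unit ≡ x * ∏.∑ unit
    key = begin
      frob n x * ∏.∑ unit                       ≡⟨ cong (_* ∏.∑ unit) (sym (∏.∑-const x)) ⟩
      ∏.∑ (λ _ → x) * ∏.∑ unit                  ≡⟨ sym (∏.∑-distrib (λ _ → x) unit) ⟩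
      ∏.∑ (λ y → x * unit y)                    ≡⟨ ∏.∑-cong shift ⟩
      ∏.∑ (λ y → unit (x * y) * defect y)       ≡⟨ ∏.∑-distrib (unit ∘ (x *_)) defect ⟩
      ∏.∑ (unit ∘ (x *_)) * ∏.∑ defect          ≡⟨ cong₂ _*_ (∏.∑-reindex (*-cancelˡ x≢0) unit) ∏defect≡x ⟩
      ∏.∑ unit * x                              ≡⟨ *-comm _ x ⟩
      x * ∏.∑ unit                              ∎

  frob-fixed-iterate : ∀ a {w} → frob a w ≡ w → ∀ c → frob (c ℕ.* a) w ≡ w
  frob-fixed-iterate a {w} fixed ℕ.zero    = *-identityʳ w
  frob-fixed-iterate a {w} fixed (ℕ.suc c) = begin
    frob (a ℕ.+ c ℕ.* a) w             ≡⟨ cong (λ e → frob e w) (ℕP.+-comm a (c ℕ.* a)) ⟩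
    frob (c ℕ.* a ℕ.+ a) w             ≡⟨ sym (frob-∘ a (c ℕ.* a) w) ⟩
    frob a (frob (c ℕ.* a) w)          ≡⟨ cong (frob a) (frob-fixed-iterate a fixed c) ⟩
    frob a w                           ≡⟨ fixed ⟩
    w                                  ∎

  frob-1-fixed⇒0or1 : ∀ {w} → frob 1 w ≡ w → w ≡ 0# ⊎ w ≡ 1#
  frob-1-fixed⇒0or1 {w} w²≡w with w ≟ 0#
  ... | yes w≡0 = inj₁ w≡0
  ... | no w≢0  = inj₂ (*-cancelʳ w≢0 (trans (cong (w *_) (sym (*-identityʳ w))) (trans w²≡w (sym (*-identityˡ w)))))

  -- Bézout gives 1 + y n = x k or 1 + x k = y n, and frob n is the identity (Fermat).
  frob-fixed⇒0or1 : ∀ {k} → gcd k n ≡ 1 → ∀ {w} → frob k w ≡ w → w ≡ 0# ⊎ w ≡ 1#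
  frob-fixed⇒0or1 {k} coprime {w} fixed =
    frob-1-fixed⇒0or1 (from-identity (Bézout.identity (subst (GCD k n) coprime (gcd-GCD k n))))
    where
    from-identity : Bézout.Identity.Identity 1 k n → frob 1 w ≡ w
    from-identity (Bézout.Identity.+- x y 1+yn≡xk) = begin
      frob 1 w                           ≡⟨ sym (frob-fixed-iterate n (fermat (frob 1 w)) y) ⟩
      frob (y ℕ.* n) (frob 1 w)          ≡⟨ frob-∘ (y ℕ.* n) 1 w ⟩
      frob (1 ℕ.+ y ℕ.* n) w             ≡⟨ cong (λ e → frob e w) 1+yn≡xk ⟩
      frob (x ℕ.* k) w                   ≡⟨ frob-fixed-iterate k fixed x ⟩
      w                                  ∎
    from-identity (Bézout.Identity.-+ x y 1+xk≡yn) = begin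
      frob 1 w                           ≡⟨ cong (frob 1) (sym (frob-fixed-iterate k fixed x)) ⟩
      frob 1 (frob (x ℕ.* k) w)          ≡⟨ frob-∘ 1 (x ℕ.* k) w ⟩
      frob (x ℕ.* k ℕ.+ 1) w             ≡⟨ cong (λ e → frob e w) (trans (ℕP.+-comm (x ℕ.* k) 1) 1+xk≡yn) ⟩
      frob (y ℕ.* n) w                   ≡⟨ frob-fixed-iterate n (fermat w) y ⟩
      w                                  ∎

  *⁻¹*-cancel : ∀ {y} x z → y ≢ 0# → x * y ⁻¹ * (y * z) ≡ x * z
  *⁻¹*-cancel {y} x z y≢0 = begin
    x * y ⁻¹ * (y * z)            ≡⟨ regroup x (y ⁻¹) y z ⟩
    x * z * (y ⁻¹ * y)            ≡⟨ cong (x * z *_) (⁻¹-inverseˡ y≢0) ⟩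
    x * z * 1#                    ≡⟨ *-identityʳ _ ⟩
    x * z                         ∎
    where
    regroup : ∀ x y′ y z → x * y′ * (y * z) ≡ x * z * (y′ * y)
    regroup = solve 4 (λ x y′ y z → x :* y′ :* (y :* z) := x :* z :* (y′ :* y)) refl

  /-cross : ∀ {a b c d} → b ≢ 0# → d ≢ 0# → a * b ⁻¹ ≡ c * d ⁻¹ → a * d ≡ c * b
  /-cross {a} {b} {c} {d} b≢0 d≢0 eq = begin
    a * d                         ≡⟨ sym (*⁻¹*-cancel a d b≢0) ⟩
    a * b ⁻¹ * (b * d)            ≡⟨ cong₂ _*_ eq (*-comm b d) ⟩
    c * d ⁻¹ * (d * b)            ≡⟨ *⁻¹*-cancel c b d≢0 ⟩
    c * b                         ∎

  /-uncross : ∀ {a b c d} → b ≢ 0# → d ≢ 0# → a * d ≡ c * b → a * b ⁻¹ ≡ c * d ⁻¹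
  /-uncross {a} {b} {c} {d} b≢0 d≢0 eq = *-cancelʳ (*-≢0 b≢0 d≢0) (begin
    a * b ⁻¹ * (b * d)            ≡⟨ *⁻¹*-cancel a d b≢0 ⟩
    a * d                         ≡⟨ eq ⟩
    c * b                         ≡⟨ sym (*⁻¹*-cancel c b d≢0) ⟩
    c * d ⁻¹ * (d * b)            ≡⟨ cong (c * d ⁻¹ *_) (*-comm d b) ⟩
    c * d ⁻¹ * (b * d)            ∎)

  frobRatio : ℕ → F → F
  frobRatio k x = x * frob k x ⁻¹

  frobRatio≡0⇒≡0 : ∀ k {x} → frobRatio k x ≡ 0# → x ≡ 0#
  frobRatio≡0⇒≡0 k {x} ratio≡0 with x ≟ 0#
  ... | yes x≡0 = x≡0
  ... | no x≢0  = ⊥-elim (*-≢0 x≢0 (⁻¹-≢0 (frob-≢0 k x≢0)) ratio≡0)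

  frobRatio-0 : ∀ k → frobRatio k 0# ≡ 0#
  frobRatio-0 k = zeroˡ _

  frob-fixed-quotient : ∀ k {x y} → x ≢ 0# → y ≢ 0# → frobRatio k x ≡ frobRatio k y →
                        frob k (x * y ⁻¹) ≡ x * y ⁻¹
  frob-fixed-quotient k {x} {y} x≢0 y≢0 eq = begin
    frob k (x * y ⁻¹)             ≡⟨ frob-* k x (y ⁻¹) ⟩
    frob k x * frob k (y ⁻¹)      ≡⟨ cong (frob k x *_) (frob-⁻¹ k y≢0) ⟩
    frob k x * frob k y ⁻¹        ≡⟨ /-uncross fy≢0 y≢0 (trans (*-comm (frob k x) y) (sym x*fy≡y*fx)) ⟩
    x * y ⁻¹                      ∎
    where
    fy≢0 = frob-≢0 k y≢0
    x*fy≡y*fx : x * frob k y ≡ y * frob k x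
    x*fy≡y*fx = /-cross (frob-≢0 k x≢0) fy≢0 eq

  frobRatio-injective : ∀ {k} → gcd k n ≡ 1 → Injective _≡_ _≡_ (frobRatio k)
  frobRatio-injective {k} coprime {x} {y} eq = cases (x ≟ 0#) (y ≟ 0#)
    where
    ≡0-transfer : ∀ {u v} → frobRatio k u ≡ frobRatio k v → u ≡ 0# → v ≡ 0#
    ≡0-transfer {u} {v} eq′ u≡0 = frobRatio≡0⇒≡0 k (trans (sym eq′) (trans (cong (frobRatio k) u≡0) (frobRatio-0 k)))
    quotient-cases : x ≢ 0# → y ≢ 0# → x * y ⁻¹ ≡ 0# ⊎ x * y ⁻¹ ≡ 1# → x ≡ y
    quotient-cases x≢0 y≢0 (inj₁ x/y≡0) = ⊥-elim (*-≢0 x≢0 (⁻¹-≢0 y≢0) x/y≡0)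
    quotient-cases x≢0 y≢0 (inj₂ x/y≡1) = *-cancelʳ (⁻¹-≢0 y≢0) (trans x/y≡1 (sym (⁻¹-inverseʳ y≢0)))
    cases : Dec (x ≡ 0#) → Dec (y ≡ 0#) → x ≡ y
    cases (yes x≡0) _        = trans x≡0 (sym (≡0-transfer eq x≡0))
    cases (no _)   (yes y≡0) = trans (≡0-transfer (sym eq) y≡0) (sym y≡0)
    cases (no x≢0) (no y≢0)  =
      quotient-cases x≢0 y≢0 (frob-fixed⇒0or1 {k} coprime (frob-fixed-quotient k x≢0 y≢0 eq))

-- Linear algebra over F

module LinearAlgebra {n : ℕ} (𝔽 : FiniteField2 n) where
  open Char2Field 𝔽
  open SemiringSum (CommutativeRing.semiring ring)
    using (sum; sum-cong-≗; ∑-distrib-+; ∑-comm; sum-remove; sum-replicate-zero; *-distribˡ-sum; *-distribʳ-sum)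
  open ≡-Reasoning

  combination : ∀ {r d} → (Fin r → F) → (Fin r → Fin d → F) → Fin d → F
  combination c X i = sum (λ j → c j * X j i)

  LinearlyDependent : ∀ {r d} → (Fin r → Fin d → F) → Set
  LinearlyDependent X = ∃ λ c → (∃ λ j → c j ≢ 0#) × (∀ i → combination c X i ≡ 0#)

  sum-≡0 : ∀ {r} (t : Fin r → F) → (∀ j → t j ≡ 0#) → sum t ≡ 0#
  sum-≡0 {r} t t≡0 = trans (sum-cong-≗ t≡0) (sum-replicate-zero r)

  combination-head≡0 : ∀ {r d} (c : Fin (ℕ.suc r) → F) (X : Fin (ℕ.suc r) → Fin d → F) i →
                       c zero ≡ 0# → combination c X i ≡ combination (c ∘ suc) (X ∘ suc) i
  combination-head≡0 c X i c₀≡0 =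
    trans (cong (λ c₀ → c₀ * X zero i + combination (c ∘ suc) (X ∘ suc) i) c₀≡0)
          (trans (cong (_+ combination (c ∘ suc) (X ∘ suc) i) (zeroˡ (X zero i)))
                 (+-identityˡ (combination (c ∘ suc) (X ∘ suc) i)))

  combination-scale : ∀ {r d} s (c : Fin r → F) (X : Fin r → Fin d → F) i →
                      combination (λ j → s * c j) X i ≡ s * combination c X i
  combination-scale s c X i =
    trans (sum-cong-≗ (λ j → *-assoc s (c j) (X j i))) (sym (*-distribˡ-sum s (λ j → c j * X j i)))

  combination-+ : ∀ {r d} (c c′ : Fin r → F) (X : Fin r → Fin d → F) i →
                  combination (λ j → c j + c′ j) X i ≡ combination c X i + combination c′ X i
  combination-+ c c′ X i =
    trans (sum-cong-≗ (λ j → distribʳ (X j i) (c j) (c′ j))) (∑-distrib-+ (λ j → c j * X j i) (λ j → c′ j * X j i))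

  dependent-zeroColumn : ∀ {r d} (X : Fin (ℕ.suc r) → Fin (ℕ.suc d) → F) → (∀ p → X p zero ≡ 0#) →
                         LinearlyDependent (λ j i → X (suc j) (suc i)) → LinearlyDependent X
  dependent-zeroColumn X column≡0 (c , (j , cⱼ≢0) , relation) = insertAt c zero 0# , (suc j , cⱼ≢0) , relation′
    where
    relation′ : ∀ i → combination (insertAt c zero 0#) X i ≡ 0#
    relation′ zero    = trans (combination-head≡0 (insertAt c zero 0#) X zero refl)
                              (sum-≡0 (λ j → c j * X (suc j) zero) (λ j → trans (cong (c j *_) (column≡0 (suc j))) (zeroʳ _)))
    relation′ (suc i) = trans (combination-head≡0 (insertAt c zero 0#) X (suc i) refl) (relation i)

  pivotRatio : ∀ {r d} (p : Fin (ℕ.suc r)) → (Fin (ℕ.suc r) → Fin (ℕ.suc d) → F) → Fin r → F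
  pivotRatio p X j = X (punchIn p j) zero * X p zero ⁻¹

  eliminate : ∀ {r d} (p : Fin (ℕ.suc r)) → (Fin (ℕ.suc r) → Fin (ℕ.suc d) → F) → Fin r → Fin d → F
  eliminate p X j i = X (punchIn p j) (suc i) + pivotRatio p X j * X p (suc i)

  -- The pivot row collects γ = Σ cⱼ · pivotRatioⱼ; in its first column γ · pivot is then added twice,
  -- which vanishes in characteristic 2.
  dependent-pivot : ∀ {r d} (X : Fin (ℕ.suc r) → Fin (ℕ.suc d) → F) p → X p zero ≢ 0# →
                    LinearlyDependent (eliminate p X) → LinearlyDependent X
  dependent-pivot {r} X p pivot≢0 (c , (j , cⱼ≢0) , relation) =
    c′ , (punchIn p j , subst (_≢ 0#) (sym (VecP.insertAt-punchIn c p γ j)) cⱼ≢0) , relation′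
    where
    multiplier : Fin r → F
    multiplier = pivotRatio p X
    γ : F
    γ = sum (λ j → c j * multiplier j)
    c′ : Fin (ℕ.suc r) → F
    c′ = insertAt c p γ
    pivot-split : ∀ l → combination c′ X l ≡ γ * X p l + combination c (X ∘ punchIn p) l
    pivot-split l = trans (sum-remove {i = p} (λ j → c′ j * X j l))
      (cong₂ _+_ (cong (_* X p l) (VecP.insertAt-lookup c p γ))
                 (sum-cong-≗ (λ j → cong (_* X (punchIn p j) l) (VecP.insertAt-punchIn c p γ j))))
    multiplied : ∀ x → sum (λ j → c j * (multiplier j * x)) ≡ γ * x
    multiplied x = trans (sum-cong-≗ (λ j → sym (*-assoc (c j) (multiplier j) x)))
                         (sym (*-distribʳ-sum x (λ j → c j * multiplier j)))
    cleared : ∀ j → multiplier j * X p zero ≡ X (punchIn p j) zero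
    cleared j = trans (*-assoc _ _ _) (trans (cong (X (punchIn p j) zero *_) (⁻¹-inverseˡ pivot≢0)) (*-identityʳ _))
    relation′ : ∀ i → combination c′ X i ≡ 0#
    relation′ zero = begin
      combination c′ X zero
        ≡⟨ pivot-split zero ⟩
      γ * X p zero + combination c (X ∘ punchIn p) zero
        ≡⟨ cong (γ * X p zero +_) (sum-cong-≗ (λ j → cong (c j *_) (sym (cleared j)))) ⟩
      γ * X p zero + sum (λ j → c j * (multiplier j * X p zero))
        ≡⟨ cong (γ * X p zero +_) (multiplied (X p zero)) ⟩
      γ * X p zero + γ * X p zero
        ≡⟨ x+x≡0 (γ * X p zero) ⟩
      0#
        ∎
    relation′ (suc i) = begin
      combination c′ X (suc i)
        ≡⟨ pivot-split (suc i) ⟩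
      γ * X p (suc i) + rest
        ≡⟨ +-comm (γ * X p (suc i)) rest ⟩
      rest + γ * X p (suc i)
        ≡⟨ cong (rest +_) (sym (multiplied (X p (suc i)))) ⟩
      rest + sum (λ j → c j * (multiplier j * X p (suc i)))
        ≡⟨ sym (trans (sum-cong-≗ (λ j → distribˡ (c j) (X (punchIn p j) (suc i)) (multiplier j * X p (suc i))))
                      (∑-distrib-+ (λ j → c j * X (punchIn p j) (suc i)) (λ j → c j * (multiplier j * X p (suc i))))) ⟩
      combination c (eliminate p X) i
        ≡⟨ relation i ⟩
      0#
        ∎
      where rest = combination c (X ∘ punchIn p) (suc i)

  overdetermined⇒dependent : ∀ d (X : Fin (ℕ.suc d) → Fin d → F) → LinearlyDependent X
  overdetermined⇒dependent ℕ.zero    X = (λ _ → 1#) , (zero , 1≢0) , (λ ())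
  overdetermined⇒dependent (ℕ.suc d) X with FinP.any? (λ p → ¬? (X p zero ≟ 0#))
  ... | yes (p , pivot≢0) = dependent-pivot X p pivot≢0 (overdetermined⇒dependent d (eliminate p X))
  ... | no noPivot        = dependent-zeroColumn X (λ p → decidable-stable (X p zero ≟ 0#) (noPivot ∘ (p ,_)))
                              (overdetermined⇒dependent d (λ j i → X (suc j) (suc i)))

  frob-sum : ∀ a {r} (t : Fin r → F) → frob a (sum t) ≡ sum (frob a ∘ t)
  frob-sum a {ℕ.zero}  t = frob-0 a
  frob-sum a {ℕ.suc r} t = trans (frob-+ a (t zero) (sum (t ∘ suc))) (cong (frob a (t zero) +_) (frob-sum a (t ∘ suc)))

  fromBool : Bool → F
  fromBool true  = 1#
  fromBool false = 0#

  F₂-Independent : ∀ {r d} → (Fin r → Fin d → F) → Set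
  F₂-Independent X = ∀ b → (∀ i → combination (fromBool ∘ b) X i ≡ 0#) → ∀ j → b j ≡ false

  F₂-Independent-tail : ∀ {r d} {X : Fin (ℕ.suc r) → Fin d → F} → F₂-Independent X → F₂-Independent (X ∘ suc)
  F₂-Independent-tail {X = X} independent b relation j =
    independent (insertAt b zero false) (λ i → trans (combination-head≡0 (fromBool ∘ insertAt b zero false) X i refl) (relation i)) (suc j)

  pad : ∀ r {e} → (Fin r → Bool) → Fin (r ℕ.+ e) → Bool
  pad ℕ.zero    b j       = false
  pad (ℕ.suc r) b zero    = b zero
  pad (ℕ.suc r) b (suc j) = pad r (b ∘ suc) j

  pad-↑ˡ : ∀ r {e} (b : Fin r → Bool) j → pad r {e} b (j Fin.↑ˡ e) ≡ b j
  pad-↑ˡ (ℕ.suc r) b zero    = refl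
  pad-↑ˡ (ℕ.suc r) b (suc j) = pad-↑ˡ r (b ∘ suc) j

  combination-pad : ∀ r {e d} b (X : Fin (r ℕ.+ e) → Fin d → F) i →
                    combination (fromBool ∘ pad r b) X i ≡ combination (fromBool ∘ b) (λ j → X (j Fin.↑ˡ e)) i
  combination-pad ℕ.zero    b X i = sum-≡0 (λ j → 0# * X j i) (λ j → zeroˡ (X j i))
  combination-pad (ℕ.suc r) b X i = cong (fromBool (b zero) * X zero i +_) (combination-pad r (b ∘ suc) (X ∘ suc) i)

  F₂-Independent-↑ˡ : ∀ {r e d} {X : Fin (r ℕ.+ e) → Fin d → F} → F₂-Independent X → F₂-Independent (λ j → X (j Fin.↑ˡ e))
  F₂-Independent-↑ˡ {r} {e} {X = X} independent b relation j =
    trans (sym (pad-↑ˡ r b j)) (independent (pad r b) (λ i → trans (combination-pad r b X i) (relation i)) (j Fin.↑ˡ e))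

  0or1⇒fromBool : ∀ x → x ≡ 0# ⊎ x ≡ 1# → fromBool (does (x ≟ 1#)) ≡ x
  0or1⇒fromBool x x∈F₂ with x ≟ 1# | x∈F₂
  ... | yes x≡1 | _        = sym x≡1
  ... | no _    | inj₁ x≡0 = sym x≡0
  ... | no x≢1  | inj₂ x≡1 = ⊥-elim (x≢1 x≡1)

  -- Lang's argument for solutions of v = A · frob a v: normalise a relation to have first coefficient 1
  -- and add its frob a–image; the shorter relation shows every coefficient is frob a–fixed, i.e. in F₂.
  module TwistedSystem (a : ℕ) (fixed⇒0or1 : ∀ {w} → frob a w ≡ w → w ≡ 0# ⊎ w ≡ 1#)
                       {d : ℕ} (A : Fin d → Fin d → F) where
    Solution : (Fin d → F) → Set
    Solution v = ∀ i → v i ≡ sum (λ l → A i l * frob a (v l))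

    frob-relation : ∀ {r} (X : Fin r → Fin d → F) → (∀ j → Solution (X j)) → ∀ c →
                    (∀ i → combination c X i ≡ 0#) → ∀ i → combination (frob a ∘ c) X i ≡ 0#
    frob-relation X solutions c relation i = begin
      sum (λ j → frob a (c j) * X j i)
        ≡⟨ sum-cong-≗ (λ j → cong (frob a (c j) *_) (solutions j i)) ⟩
      sum (λ j → frob a (c j) * sum (λ l → A i l * frob a (X j l)))
        ≡⟨ sum-cong-≗ (λ j → *-distribˡ-sum (frob a (c j)) (λ l → A i l * frob a (X j l))) ⟩
      sum (λ j → sum (λ l → frob a (c j) * (A i l * frob a (X j l))))
        ≡⟨ sum-cong-≗ (λ j → sum-cong-≗ (λ l → swap (c j) (A i l) (X j l))) ⟩
      sum (λ j → sum (λ l → A i l * frob a (c j * X j l)))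
        ≡⟨ ∑-comm (λ j l → A i l * frob a (c j * X j l)) ⟩
      sum (λ l → sum (λ j → A i l * frob a (c j * X j l)))
        ≡⟨ sum-cong-≗ (λ l → sym (*-distribˡ-sum (A i l) (λ j → frob a (c j * X j l)))) ⟩
      sum (λ l → A i l * sum (λ j → frob a (c j * X j l)))
        ≡⟨ sum-cong-≗ (λ l → cong (A i l *_) (sym (frob-sum a (λ j → c j * X j l)))) ⟩
      sum (λ l → A i l * frob a (combination c X l))
        ≡⟨ sum-≡0 (λ l → A i l * frob a (combination c X l)) vanishes ⟩
      0#
        ∎
      where
      vanishes : ∀ l → A i l * frob a (combination c X l) ≡ 0#
      vanishes l = trans (cong (λ w → A i l * frob a w) (relation l)) (trans (cong (A i l *_) (frob-0 a)) (zeroʳ (A i l)))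
      swap : ∀ x y z → frob a x * (y * frob a z) ≡ y * frob a (x * z)
      swap x y z = trans (solve 3 (λ x y z → x :* (y :* z) := y :* (x :* z)) refl (frob a x) y (frob a z))
                         (cong (y *_) (sym (frob-* a x z)))

    F₂-independent⇒independent : ∀ {r} (X : Fin r → Fin d → F) → (∀ j → Solution (X j)) → F₂-Independent X →
                                 ∀ c → (∀ i → combination c X i ≡ 0#) → ∀ j → c j ≡ 0#
    F₂-independent⇒independent {ℕ.suc r} X solutions independent c relation = head-trivial c relation (head≡0 (c zero ≟ 0#))
      where
      head-trivial : ∀ e → (∀ i → combination e X i ≡ 0#) → e zero ≡ 0# → ∀ j → e j ≡ 0#
      head-trivial e _ e₀≡0 zero = e₀≡0
      head-trivial e relationₑ e₀≡0 (suc j) =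
        F₂-independent⇒independent {r} (X ∘ suc) (solutions ∘ suc) (F₂-Independent-tail {X = X} independent) (e ∘ suc)
          (λ i → trans (sym (combination-head≡0 e X i e₀≡0)) (relationₑ i)) j
      head≡0 : Dec (c zero ≡ 0#) → c zero ≡ 0#
      head≡0 (yes c₀≡0) = c₀≡0
      head≡0 (no c₀≢0)  = ⊥-elim (1≢0 (begin
        1#                  ≡⟨ sym c′₀≡1 ⟩
        c′ zero             ≡⟨ sym (0or1⇒fromBool (c′ zero) (inF₂ zero)) ⟩
        fromBool (b zero)   ≡⟨ cong fromBool (independent b relation-b zero) ⟩
        0#                  ∎))
        where
        c′ : Fin (ℕ.suc r) → F
        c′ j = c zero ⁻¹ * c j
        c′₀≡1 : c′ zero ≡ 1#
        c′₀≡1 = ⁻¹-inverseˡ c₀≢0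
        relation′ : ∀ i → combination c′ X i ≡ 0#
        relation′ i = trans (combination-scale (c zero ⁻¹) c X i) (trans (cong (c zero ⁻¹ *_) (relation i)) (zeroʳ (c zero ⁻¹)))
        inF₂ : ∀ j → c′ j ≡ 0# ⊎ c′ j ≡ 1#
        inF₂ j = fixed⇒0or1 (+≡0⇒≡ (head-trivial (λ j → frob a (c′ j) + c′ j)
          (λ i → trans (combination-+ (frob a ∘ c′) c′ X i)
                       (trans (cong₂ _+_ (frob-relation X solutions c′ relation′ i) (relation′ i)) (+-identityˡ 0#)))
          (trans (cong (λ w → frob a w + w) c′₀≡1) (trans (cong (_+ 1#) (frob-1 a)) (x+x≡0 1#))) j))
        b : Fin (ℕ.suc r) → Bool
        b j = does (c′ j ≟ 1#)
        relation-b : ∀ i → combination (fromBool ∘ b) X i ≡ 0#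
        relation-b i = trans (sum-cong-≗ (λ j → cong (_* X j i) (0or1⇒fromBool (c′ j) (inF₂ j)))) (relation′ i)

    overdetermined-not-F₂-independent : (X : Fin (ℕ.suc d) → Fin d → F) → (∀ j → Solution (X j)) → ¬ F₂-Independent X
    overdetermined-not-F₂-independent X solutions independent =
      cⱼ≢0 (F₂-independent⇒independent X solutions independent c relation j)
      where
      dependency = overdetermined⇒dependent d X
      c = proj₁ dependency
      j = proj₁ (proj₁ (proj₂ dependency))
      cⱼ≢0 = proj₂ (proj₁ (proj₂ dependency))
      relation = proj₂ (proj₂ dependency)

-- F₂-linear combinations in F²

module F₂Span {n : ℕ} (𝔽 : FiniteField2 n) where
  open Char2Field 𝔽
  open FiniteField2 𝔽 using (F²; _+²_; 0²)
  open LinearAlgebra 𝔽 using (fromBool)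
  open SemiringSum (CommutativeRing.semiring ring) using (sum)

  Independent : ∀ {i} → (Fin i → F²) → Set
  Independent {i} v = ∀ (c : Fin i → Bool) → lincomb 𝔽 i c v ≡ 0² → ∀ j → c j ≡ false

  select : Bool → F² → F²
  select b w = if b then w else 0²

  +²-identityˡ : ∀ w → 0² +² w ≡ w
  +²-identityˡ (a , b) = cong₂ _,_ (+-identityˡ a) (+-identityˡ b)

  w+²w≡0² : ∀ w → w +² w ≡ 0²
  w+²w≡0² (a , b) = cong₂ _,_ (x+x≡0 a) (x+x≡0 b)

  +²-interchange : ∀ p q r t → (p +² q) +² (r +² t) ≡ (p +² r) +² (q +² t)
  +²-interchange (p₁ , p₂) (q₁ , q₂) (r₁ , r₂) (t₁ , t₂) =
    cong₂ _,_ (+-interchange p₁ q₁ r₁ t₁) (+-interchange p₂ q₂ r₂ t₂)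

  select-xor : ∀ a b w → select a w +² select b w ≡ select (a xor b) w
  select-xor false b     w = +²-identityˡ (select b w)
  select-xor true  false (w₁ , w₂) = cong₂ _,_ (+-identityʳ w₁) (+-identityʳ w₂)
  select-xor true  true  w = w+²w≡0² w

  lincomb-xor : ∀ i (c c′ : Fin i → Bool) v → lincomb 𝔽 i c v +² lincomb 𝔽 i c′ v ≡ lincomb 𝔽 i (λ j → c j xor c′ j) v
  lincomb-xor ℕ.zero    c c′ v = +²-identityˡ 0²
  lincomb-xor (ℕ.suc i) c c′ v = trans (+²-interchange (select (c zero) (v zero)) _ (select (c′ zero) (v zero)) _)
    (cong₂ _+²_ (select-xor (c zero) (c′ zero) (v zero)) (lincomb-xor i (c ∘ suc) (c′ ∘ suc) (v ∘ suc)))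

  lincomb-injective : ∀ {i} {v : Fin i → F²} → Independent v → ∀ {c c′} → lincomb 𝔽 i c v ≡ lincomb 𝔽 i c′ v → c ≗ c′
  lincomb-injective {i} {v} independent {c} {c′} eq j =
    xor≡false⇒≡ (c j) (c′ j) (independent (λ j → c j xor c′ j) xor-relation j)
    where
    xor-relation : lincomb 𝔽 i (λ j → c j xor c′ j) v ≡ 0²
    xor-relation = trans (sym (lincomb-xor i c c′ v)) (trans (cong (_+² lincomb 𝔽 i c′ v) eq) (w+²w≡0² _))
    xor≡false⇒≡ : ∀ a b → a xor b ≡ false → a ≡ b
    xor≡false⇒≡ false false _ = refl
    xor≡false⇒≡ true  true  _ = refl

  lincomb-congˡ : ∀ i {c c′} → c ≗ c′ → ∀ v → lincomb 𝔽 i c v ≡ lincomb 𝔽 i c′ v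
  lincomb-congˡ ℕ.zero    c≗c′ v = refl
  lincomb-congˡ (ℕ.suc i) c≗c′ v =
    cong₂ (λ b r → select b (v zero) +² r) (c≗c′ zero) (lincomb-congˡ i (c≗c′ ∘ suc) (v ∘ suc))

  lincomb-congʳ : ∀ i c {v v′ : Fin i → F²} → v ≗ v′ → lincomb 𝔽 i c v ≡ lincomb 𝔽 i c v′
  lincomb-congʳ ℕ.zero    c v≗v′ = refl
  lincomb-congʳ (ℕ.suc i) c v≗v′ =
    cong₂ (λ w r → select (c zero) w +² r) (v≗v′ zero) (lincomb-congʳ i (c ∘ suc) (v≗v′ ∘ suc))

  lincomb-closed : (W : F² → Set) → W 0² → (∀ {w w′} → W w → W w′ → W (w +² w′)) →
                   ∀ i c v → (∀ j → W (v j)) → W (lincomb 𝔽 i c v)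
  lincomb-closed W W0 W+ ℕ.zero    c v Wv = W0
  lincomb-closed W W0 W+ (ℕ.suc i) c v Wv = W+ (select-closed (c zero)) (lincomb-closed W W0 W+ i (c ∘ suc) (v ∘ suc) (Wv ∘ suc))
    where
    select-closed : ∀ b → W (select b (v zero))
    select-closed true  = Wv zero
    select-closed false = W0

  lincomb-additive : (f : F → F²) → f 0# ≡ 0² → (∀ x y → f (x + y) ≡ f x +² f y) →
                     ∀ i c xs → lincomb 𝔽 i c (f ∘ xs) ≡ f (sum (λ j → fromBool (c j) * xs j))
  lincomb-additive f f0 f+ ℕ.zero    c xs = sym f0
  lincomb-additive f f0 f+ (ℕ.suc i) c xs =
    trans (cong₂ _+²_ (select-f (c zero) (xs zero)) (lincomb-additive f f0 f+ i (c ∘ suc) (xs ∘ suc))) (sym (f+ _ _))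
    where
    select-f : ∀ b x → select b (f x) ≡ f (fromBool b * x)
    select-f true  x = cong f (sym (*-identityˡ x))
    select-f false x = trans (sym f0) (cong f (sym (zeroˡ x)))

-- The planes P_μ meeting U_s

module Setting (m s : ℕ) (𝔽 : FiniteField2 (3 ℕ.* m)) (coprime : gcd (s ℕ.+ m) (3 ℕ.* m) ≡ 1) where
  open Char2Field 𝔽
  open FiniteField2 𝔽 using (F²; _+²_; 0²)
  open LinearAlgebra 𝔽
  open SemiringSum (CommutativeRing.semiring ring) using (sum)
  open F₂Span 𝔽
  open ≡-Reasoning

  k : ℕ
  k = m ℕ.+ s

  frob-period : ∀ a x → frob (a ℕ.+ 3 ℕ.* m) x ≡ frob a x
  frob-period a x = trans (sym (frob-∘ (3 ℕ.* m) a x)) (fermat (frob a x))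

  U-point : F → F²
  U-point x = (frob s x , frob k x + x)

  U-point-0 : U-point 0# ≡ 0²
  U-point-0 = cong₂ _,_ (frob-0 s) (trans (cong (_+ 0#) (frob-0 k)) (+-identityʳ 0#))

  U-point-+ : ∀ x y → U-point (x + y) ≡ U-point x +² U-point y
  U-point-+ x y = cong₂ _,_ (frob-+ s x y) (trans (cong (_+ (x + y)) (frob-+ k x y)) (+-interchange (frob k x) (frob k y) x y))

  U-point-injective : Injective _≡_ _≡_ U-point
  U-point-injective eq = frob-injective s (cong proj₁ eq)

  -- (x^{2^s}, x^{2^k} + x) lies on the line P_μ exactly when this holds.
  Root : F → F → Set
  Root μ x = frob k x + x ≡ frob s x * μ

  Root? : ∀ μ x → Dec (Root μ x)
  Root? μ x = frob k x + x ≟ frob s x * μ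

  Root-0 : ∀ μ → Root μ 0#
  Root-0 μ = trans (cong proj₂ U-point-0) (sym (trans (cong (_* μ) (frob-0 s)) (zeroˡ μ)))

  Root-+ : ∀ μ {x y} → Root μ x → Root μ y → Root μ (x + y)
  Root-+ μ {x} {y} rx ry = begin
    frob k (x + y) + (x + y)              ≡⟨ cong proj₂ (U-point-+ x y) ⟩
    (frob k x + x) + (frob k y + y)       ≡⟨ cong₂ _+_ rx ry ⟩
    frob s x * μ + frob s y * μ           ≡⟨ sym (distribʳ μ (frob s x) (frob s y)) ⟩
    (frob s x + frob s y) * μ             ≡⟨ cong (_* μ) (sym (frob-+ s x y)) ⟩
    frob s (x + y) * μ                    ∎

  U-point≡ : ∀ x → U-point x ≡ (FiniteField2._^F_ 𝔽 x (2 ℕ.^ s) , FiniteField2._^F_ 𝔽 x (2 ℕ.^ (m ℕ.+ s)) + x)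
  U-point≡ x = sym (cong₂ _,_ (^F≡^ x (2 ℕ.^ s)) (cong (_+ x) (^F≡^ x (2 ℕ.^ k))))

  Root⇒PU : ∀ {μ x} → Root μ x → PU m 𝔽 s μ (U-point x)
  Root⇒PU {μ} {x} root = (frob s x , cong (frob s x ,_) root) , (x , U-point≡ x)

  PU⇒Root : ∀ {μ w} → PU m 𝔽 s μ w → ∃ λ x → Root μ x × w ≡ U-point x
  PU⇒Root {μ} ((l , w≡line) , (x , w≡U)) = x , root , w≡U′
    where
    w≡U′ = trans w≡U (sym (U-point≡ x))
    on-line : (l , l * μ) ≡ U-point x
    on-line = trans (sym w≡line) w≡U′
    root : Root μ x
    root = trans (sym (cong proj₂ on-line)) (cong (_* μ) (cong proj₁ on-line))

  PU-0 : ∀ μ → PU m 𝔽 s μ 0²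
  PU-0 μ = subst (PU m 𝔽 s μ) U-point-0 (Root⇒PU (Root-0 μ))

  PU-+ : ∀ μ {w w′} → PU m 𝔽 s μ w → PU m 𝔽 s μ w′ → PU m 𝔽 s μ (w +² w′)
  PU-+ μ pw pw′ with PU⇒Root pw | PU⇒Root pw′
  ... | x , rx , refl | y , ry , refl = subst (PU m 𝔽 s μ) (U-point-+ x y) (Root⇒PU (Root-+ μ rx ry))

  open Count (FiniteField2.card 𝔽) using (∑; count↔)

  #Root≡2^dim : ∀ {μ d} → HasDimF2 𝔽 (PU m 𝔽 s μ) d → ∑ (χ ∘ Root? μ) ≡ 2 ℕ.^ d
  #Root≡2^dim {μ} {d} (v , inPU , independent , spanning) =
    card≡2^ (count↔ (Root? μ) ≡-irrelevant) coordinates coordinates-injective point point-injective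
    where
    coordinates : Σ F (Root μ) → Fin d → Bool
    coordinates (x , root) = proj₁ (spanning (U-point x) (Root⇒PU root))
    coordinates-injective : ∀ {a b} → coordinates a ≗ coordinates b → a ≡ b
    coordinates-injective {x , rx} {y , ry} eq = Σ-≡,≡→≡ (x≡y , ≡-irrelevant _ _)
      where
      x≡y : x ≡ y
      x≡y = U-point-injective (begin
        U-point x                                ≡⟨ sym (proj₂ (spanning (U-point x) (Root⇒PU rx))) ⟩
        lincomb 𝔽 d (coordinates (x , rx)) v     ≡⟨ lincomb-congˡ d eq v ⟩
        lincomb 𝔽 d (coordinates (y , ry)) v     ≡⟨ proj₂ (spanning (U-point y) (Root⇒PU ry)) ⟩
        U-point y                                ∎)
    lift : ∀ c → ∃ λ x → Root μ x × lincomb 𝔽 d c v ≡ U-point x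
    lift c = PU⇒Root (lincomb-closed (PU m 𝔽 s μ) (PU-0 μ) (PU-+ μ) d c v inPU)
    point : (Fin d → Bool) → Σ F (Root μ)
    point c = proj₁ (lift c) , proj₁ (proj₂ (lift c))
    point-injective : ∀ {c c′} → point c ≡ point c′ → c ≗ c′
    point-injective {c} {c′} eq = lincomb-injective independent
      (trans (proj₂ (proj₂ (lift c))) (trans (cong (U-point ∘ proj₁) eq) (sym (proj₂ (proj₂ (lift c′))))))

  Root-frob : ∀ a {μ x} → Root μ x → Root (frob a μ) (frob a x)
  Root-frob a {μ} {x} root = begin
    frob k (frob a x) + frob a x          ≡⟨ cong (_+ frob a x) (frob-comm k a x) ⟩
    frob a (frob k x) + frob a x          ≡⟨ sym (frob-+ a (frob k x) x) ⟩
    frob a (frob k x + x)                 ≡⟨ cong (frob a) root ⟩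
    frob a (frob s x * μ)                 ≡⟨ frob-* a (frob s x) μ ⟩
    frob a (frob s x) * frob a μ          ≡⟨ cong (_* frob a μ) (frob-comm a s x) ⟩
    frob s (frob a x) * frob a μ          ∎

  Root⇒twisted : ∀ {ν y z} → Root ν y → frob s y ≡ frob k z → y ≡ frob k y + ν * frob k z
  Root⇒twisted {ν} {y} {z} root shift = begin
    y                                     ≡⟨ sym (a+[a+x]≡x (frob k y) y) ⟩
    frob k y + (frob k y + y)             ≡⟨ cong (frob k y +_) (trans root (cong (_* ν) shift)) ⟩
    frob k y + frob k z * ν               ≡⟨ cong (frob k y +_) (*-comm (frob k z) ν) ⟩
    frob k y + ν * frob k z               ∎

  conjugates : F → Fin 3 → F
  conjugates x zero             = x
  conjugates x (suc zero)       = frob m x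
  conjugates x (suc (suc zero)) = frob (2 ℕ.* m) x

  -- Row i pairs the i-th conjugate of a root with the previous one (cyclically), since
  -- frob s (frob (i m) x) = frob k (frob ((i − 1) m) x) by the 3m-periodicity of frob.
  twist : F → Fin 3 → Fin 3 → F
  twist μ zero             zero             = 1#
  twist μ zero             (suc (suc zero)) = μ
  twist μ (suc zero)       zero             = frob m μ
  twist μ (suc zero)       (suc zero)       = 1#
  twist μ (suc (suc zero)) (suc zero)       = frob (2 ℕ.* m) μ
  twist μ (suc (suc zero)) (suc (suc zero)) = 1#
  twist μ _                _                = 0#

  k-coprime : gcd k (3 ℕ.* m) ≡ 1
  k-coprime = subst (λ e → gcd e (3 ℕ.* m) ≡ 1) (ℕP.+-comm s m) coprime

  module Twisted (μ : F) = TwistedSystem k (frob-fixed⇒0or1 {k} k-coprime) (twist μ)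

  conjugates-solution : ∀ {μ x} → Root μ x → Twisted.Solution μ (conjugates x)
  conjugates-solution {μ} {x} root zero =
    trans (Root⇒twisted root shift₀)
          (row₀ (frob k x) (frob k (frob m x)) (frob k (frob (2 ℕ.* m) x)) μ)
    where
    shift₀ : frob s x ≡ frob k (frob (2 ℕ.* m) x)
    shift₀ = sym (trans (frob-∘ k (2 ℕ.* m) x) (trans (cong (λ e → frob e x) (ℕ-solve m s)) (frob-period s x)))
      where
      ℕ-solve : ∀ m s → 2 ℕ.* m ℕ.+ (m ℕ.+ s) ≡ s ℕ.+ 3 ℕ.* m
      ℕ-solve = ℕ-ring-solve
    row₀ : ∀ a b c u → a + u * c ≡ 1# * a + (0# * b + (u * c + 0#))
    row₀ = solve 4 (λ a b c u → a :+ u :* c := con 1 :* a :+ (con 0 :* b :+ (u :* c :+ con 0))) refl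
  conjugates-solution {μ} {x} root (suc zero) =
    trans (Root⇒twisted (Root-frob m root) (frob-∘ s m x))
          (row₁ (frob k x) (frob k (frob m x)) (frob k (frob (2 ℕ.* m) x)) (frob m μ))
    where
    row₁ : ∀ a b c u → b + u * a ≡ u * a + (1# * b + (0# * c + 0#))
    row₁ = solve 4 (λ a b c u → b :+ u :* a := u :* a :+ (con 1 :* b :+ (con 0 :* c :+ con 0))) refl
  conjugates-solution {μ} {x} root (suc (suc zero)) =
    trans (Root⇒twisted (Root-frob (2 ℕ.* m) root) shift₂)
          (row₂ (frob k x) (frob k (frob m x)) (frob k (frob (2 ℕ.* m) x)) (frob (2 ℕ.* m) μ))
    where
    shift₂ : frob s (frob (2 ℕ.* m) x) ≡ frob k (frob m x)
    shift₂ = trans (frob-∘ s (2 ℕ.* m) x) (trans (cong (λ e → frob e x) (ℕ-solve m s)) (sym (frob-∘ k m x)))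
      where
      ℕ-solve : ∀ m s → 2 ℕ.* m ℕ.+ s ≡ m ℕ.+ (m ℕ.+ s)
      ℕ-solve = ℕ-ring-solve
    row₂ : ∀ a b c u → c + u * b ≡ 0# * a + (u * b + (1# * c + 0#))
    row₂ = solve 4 (λ a b c u → c :+ u :* b := con 0 :* a :+ (u :* b :+ (con 1 :* c :+ con 0))) refl

  dim≤3 : ∀ {μ d} → HasDimF2 𝔽 (PU m 𝔽 s μ) d → d ℕ.≤ 3
  dim≤3 {d = 0} _ = z≤n
  dim≤3 {d = 1} _ = s≤s z≤n
  dim≤3 {d = 2} _ = s≤s (s≤s z≤n)
  dim≤3 {d = 3} _ = s≤s (s≤s (s≤s z≤n))
  dim≤3 {μ} {d = ℕ.suc (ℕ.suc (ℕ.suc (ℕ.suc e)))} (v , inPU , independent , _) =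
    ⊥-elim (Twisted.overdetermined-not-F₂-independent μ (λ j → X (j Fin.↑ˡ e)) (λ j → solutions (j Fin.↑ˡ e))
              (F₂-Independent-↑ˡ {4} {e} {X = X} X-independent))
    where
    root : ∀ j → ∃ λ x → Root μ x × v j ≡ U-point x
    root j = PU⇒Root (inPU j)
    x : Fin (4 ℕ.+ e) → F
    x j = proj₁ (root j)
    X : Fin (4 ℕ.+ e) → Fin 3 → F
    X j = conjugates (x j)
    solutions : ∀ j → Twisted.Solution μ (X j)
    solutions j = conjugates-solution (proj₁ (proj₂ (root j)))
    X-independent : F₂-Independent X
    X-independent b relation = independent b (begin
      lincomb 𝔽 (4 ℕ.+ e) b v                           ≡⟨ lincomb-congʳ (4 ℕ.+ e) b (λ j → proj₂ (proj₂ (root j))) ⟩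
      lincomb 𝔽 (4 ℕ.+ e) b (U-point ∘ x)               ≡⟨ lincomb-additive U-point U-point-0 U-point-+ (4 ℕ.+ e) b x ⟩
      U-point (sum (λ j → fromBool (b j) * x j))        ≡⟨ cong U-point (relation zero) ⟩
      U-point 0#                                        ≡⟨ U-point-0 ⟩
      0²                                                ∎)

  N : F → F
  N = Norm m 𝔽

  normExponent : ℕ
  normExponent = 2 ℕ.^ (2 ℕ.* m) ℕ.+ 2 ℕ.^ m ℕ.+ 1

  N≡^ : ∀ x → N x ≡ x ^ normExponent
  N≡^ x = ^F≡^ x normExponent

  N-* : ∀ x y → N (x * y) ≡ N x * N y
  N-* x y = trans (N≡^ (x * y)) (trans (^-distrib-* x y normExponent) (sym (cong₂ _*_ (N≡^ x) (N≡^ y))))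

  N-1 : N 1# ≡ 1#
  N-1 = trans (N≡^ 1#) (1^k≡1 normExponent)

  N-⁻¹ : ∀ {x} → x ≢ 0# → N (x ⁻¹) ≡ N x ⁻¹
  N-⁻¹ = homomorphism-⁻¹ N N-1 N-*

  N-frob : ∀ a x → N (frob a x) ≡ frob a (N x)
  N-frob a x = begin
    N (frob a x)                                ≡⟨ N≡^ (frob a x) ⟩
    (x ^ (2 ℕ.^ a)) ^ normExponent              ≡⟨ ^-assocʳ x (2 ℕ.^ a) normExponent ⟩
    x ^ (2 ℕ.^ a ℕ.* normExponent)              ≡⟨ cong (x ^_) (ℕP.*-comm (2 ℕ.^ a) normExponent) ⟩
    x ^ (normExponent ℕ.* 2 ℕ.^ a)              ≡⟨ sym (^-assocʳ x normExponent (2 ℕ.^ a)) ⟩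
    frob a (x ^ normExponent)                   ≡⟨ cong (frob a) (sym (N≡^ x)) ⟩
    frob a (N x)                                ∎

  N≡conjugates : ∀ x → N x ≡ frob (2 ℕ.* m) x * frob m x * x
  N≡conjugates x = begin
    N x                                                         ≡⟨ N≡^ x ⟩
    x ^ (2 ℕ.^ (2 ℕ.* m) ℕ.+ 2 ℕ.^ m ℕ.+ 1)                     ≡⟨ ^-homo-* x (2 ℕ.^ (2 ℕ.* m) ℕ.+ 2 ℕ.^ m) 1 ⟩
    x ^ (2 ℕ.^ (2 ℕ.* m) ℕ.+ 2 ℕ.^ m) * (x * 1#)                ≡⟨ cong₂ _*_ (^-homo-* x (2 ℕ.^ (2 ℕ.* m)) (2 ℕ.^ m)) (*-identityʳ x) ⟩
    frob (2 ℕ.* m) x * frob m x * x                             ∎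

  -- frob m permutes the three factors of N x = x^{2^{2m}} · x^{2^m} · x.
  frob-m-N : ∀ x → frob m (N x) ≡ N x
  frob-m-N x = begin
    frob m (N x)                                                ≡⟨ cong (frob m) (N≡conjugates x) ⟩
    frob m (frob (2 ℕ.* m) x * frob m x * x)                    ≡⟨ trans (frob-* m _ x) (cong (_* frob m x) (frob-* m _ (frob m x))) ⟩
    frob m (frob (2 ℕ.* m) x) * frob m (frob m x) * frob m x    ≡⟨ cong₂ (λ a b → a * b * frob m x) third second ⟩
    x * frob (2 ℕ.* m) x * frob m x                             ≡⟨ rotate x (frob (2 ℕ.* m) x) (frob m x) ⟩
    frob (2 ℕ.* m) x * frob m x * x                             ≡⟨ sym (N≡conjugates x) ⟩
    N x                                                         ∎
    where
    third : frob m (frob (2 ℕ.* m) x) ≡ x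
    third = trans (frob-∘ m (2 ℕ.* m) x) (trans (cong (λ e → frob e x) (ℕ-solve m)) (fermat x))
      where
      ℕ-solve : ∀ m → 2 ℕ.* m ℕ.+ m ≡ 3 ℕ.* m
      ℕ-solve = ℕ-ring-solve
    second : frob m (frob m x) ≡ frob (2 ℕ.* m) x
    second = trans (frob-∘ m m x) (cong (λ e → frob e x) (ℕ-solve m))
      where
      ℕ-solve : ∀ m → m ℕ.+ m ≡ 2 ℕ.* m
      ℕ-solve = ℕ-ring-solve
    rotate : ∀ a b c → a * b * c ≡ b * c * a
    rotate = solve 3 (λ a b c → a :* b :* c := b :* c :* a) refl

  N-frob-k≡N-frob-s : ∀ x → N (frob k x) ≡ N (frob s x)
  N-frob-k≡N-frob-s x = begin
    N (frob k x)                  ≡⟨ N-frob k x ⟩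
    frob (m ℕ.+ s) (N x)          ≡⟨ sym (frob-∘ s m (N x)) ⟩
    frob s (frob m (N x))         ≡⟨ cong (frob s) (frob-m-N x) ⟩
    frob s (N x)                  ≡⟨ sym (N-frob s x) ⟩
    N (frob s x)                  ∎

  μ-of : F → F
  μ-of x = (frob k x + x) * frob s x ⁻¹

  Root⇔μ-of : ∀ {μ x} → x ≢ 0# → (Root μ x → μ-of x ≡ μ) × (μ-of x ≡ μ → Root μ x)
  Root⇔μ-of {μ} {x} x≢0 =
    (λ root → trans (cong (_* B ⁻¹) (trans root (*-comm B μ))) (*-*⁻¹-cancel μ B≢0)) ,
    (λ μ-of≡μ → trans (sym (*⁻¹-*-cancel (frob k x + x) B≢0)) (trans (cong (_* B) μ-of≡μ) (*-comm μ B)))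
    where
    B = frob s x
    B≢0 = frob-≢0 s x≢0

  N-μ-of : ∀ {x} → x ≢ 0# → N (μ-of x) ≡ N (1# + frobRatio k x)
  N-μ-of {x} x≢0 = begin
    N ((A + x) * frob s x ⁻¹)                   ≡⟨ N-* (A + x) (frob s x ⁻¹) ⟩
    N (A + x) * N (frob s x ⁻¹)                 ≡⟨ cong (N (A + x) *_) (N-⁻¹ (frob-≢0 s x≢0)) ⟩
    N (A + x) * N (frob s x) ⁻¹                 ≡⟨ cong (λ y → N (A + x) * y ⁻¹) (sym (N-frob-k≡N-frob-s x)) ⟩
    N (A + x) * N A ⁻¹                          ≡⟨ cong (N (A + x) *_) (sym (N-⁻¹ A≢0)) ⟩
    N (A + x) * N (A ⁻¹)                        ≡⟨ sym (N-* (A + x) (A ⁻¹)) ⟩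
    N ((A + x) * A ⁻¹)                          ≡⟨ cong N (trans (distribʳ (A ⁻¹) A x) (cong (_+ x * A ⁻¹) (⁻¹-inverseʳ A≢0))) ⟩
    N (1# + frobRatio k x)                      ∎
    where
    A = frob k x
    A≢0 = frob-≢0 k x≢0

  module Counting (α : F) (α≢1 : α ≢ 1#) (dim : F → ℕ) (hasDim : ∀ μ → HasDimF2 𝔽 (PU m 𝔽 s μ) (dim μ)) where
    open Count (FiniteField2.card 𝔽) using (∑-cong; ∑-reindex; ∑-fibres; ∑-distrib; ∑-δ; ∑-scale)

    inFibre : ∀ μ → Dec (N μ ≡ α)
    inFibre μ = N μ ≟ α

    nonzeroRoots : F → ℕ
    nonzeroRoots μ = ∑ (λ x → χ (¬? (x ≟ 0#)) ℕ.* χ (μ-of x ≟ μ))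

    nonzeroRoots+1≡2^dim : ∀ μ → nonzeroRoots μ ℕ.+ 1 ≡ 2 ℕ.^ dim μ
    nonzeroRoots+1≡2^dim μ = begin
      nonzeroRoots μ ℕ.+ 1
        ≡⟨ cong (nonzeroRoots μ ℕ.+_) (sym (∑-δ _≟_ 0# (λ _ → 1))) ⟩
      nonzeroRoots μ ℕ.+ ∑ (λ x → χ (0# ≟ x) ℕ.* 1)
        ≡⟨ sym (∑-distrib (λ x → χ (¬? (x ≟ 0#)) ℕ.* χ (μ-of x ≟ μ)) (λ x → χ (0# ≟ x) ℕ.* 1)) ⟩
      ∑ (λ x → χ (¬? (x ≟ 0#)) ℕ.* χ (μ-of x ≟ μ) ℕ.+ χ (0# ≟ x) ℕ.* 1)
        ≡⟨ ∑-cong split ⟩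
      ∑ (χ ∘ Root? μ)
        ≡⟨ #Root≡2^dim (hasDim μ) ⟩
      2 ℕ.^ dim μ
        ∎
      where
      split : ∀ x → χ (¬? (x ≟ 0#)) ℕ.* χ (μ-of x ≟ μ) ℕ.+ χ (0# ≟ x) ℕ.* 1 ≡ χ (Root? μ x)
      split x with x ≟ 0# | 0# ≟ x
      ... | yes refl | yes _   = sym (χ-cong (Root? μ 0#) (yes (Root-0 μ)) (λ r → r) (λ r → r))
      ... | yes x≡0  | no 0≢x = ⊥-elim (0≢x (sym x≡0))
      ... | no x≢0   | yes 0≡x = ⊥-elim (x≢0 (sym 0≡x))
      ... | no x≢0   | no _    = trans (ℕP.+-identityʳ _)
            (trans (ℕP.+-identityʳ _) (χ-cong (μ-of x ≟ μ) (Root? μ x) (proj₂ (Root⇔μ-of x≢0)) (proj₁ (Root⇔μ-of x≢0))))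

    -- Each μ in the fibre is counted once per nonzero root; reindexing by x ↦ 1 + x / x^{2^k} counts the fibre itself.
    fibre≡weighted : ∑ (χ ∘ inFibre) ≡ ∑ (λ μ → χ (inFibre μ) ℕ.* nonzeroRoots μ)
    fibre≡weighted = begin
      ∑ (χ ∘ inFibre)
        ≡⟨ sym (∑-reindex shift-injective (χ ∘ inFibre)) ⟩
      ∑ (λ x → χ (inFibre (1# + frobRatio k x)))
        ≡⟨ ∑-cong pointwise ⟩
      ∑ (λ x → χ (¬? (x ≟ 0#)) ℕ.* χ (inFibre (μ-of x)))
        ≡⟨ ∑-fibres _≟_ (λ x → χ (¬? (x ≟ 0#))) μ-of (χ ∘ inFibre) ⟩
      ∑ (λ μ → χ (inFibre μ) ℕ.* nonzeroRoots μ)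
        ∎
      where
      shift-injective : Injective _≡_ _≡_ (λ x → 1# + frobRatio k x)
      shift-injective eq = frobRatio-injective {k} k-coprime (+-cancelˡ 1# eq)
      pointwise : ∀ x → χ (inFibre (1# + frobRatio k x)) ≡ χ (¬? (x ≟ 0#)) ℕ.* χ (inFibre (μ-of x))
      pointwise x with x ≟ 0#
      ... | yes refl = χ-≡0 (inFibre (1# + frobRatio k 0#)) (λ N≡α → α≢1 (trans (sym N≡α) N-at-0))
        where
        N-at-0 : N (1# + frobRatio k 0#) ≡ 1#
        N-at-0 = trans (cong N (trans (cong (1# +_) (frobRatio-0 k)) (+-identityʳ 1#))) N-1
      ... | no x≢0   = trans (χ-cong (inFibre _) (inFibre (μ-of x)) (trans (N-μ-of x≢0)) (trans (sym (N-μ-of x≢0))))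
                             (sym (ℕP.+-identityʳ _))

    count : ℕ → ℕ
    count i = ∑ (λ μ → χ (inFibre μ ×-dec dim μ ℕ.≟ i))

    fibre-by-dim : ∑ (χ ∘ inFibre) ≡ count 0 ℕ.+ count 1 ℕ.+ count 2 ℕ.+ count 3
    fibre-by-dim = trans (∑-cong (λ μ → χ-by-value (inFibre μ) (dim μ) (dim≤3 (hasDim μ))))
      (trans (∑-distrib (λ μ → c 0 μ ℕ.+ c 1 μ ℕ.+ c 2 μ) (c 3))
        (cong (ℕ._+ count 3) (trans (∑-distrib (λ μ → c 0 μ ℕ.+ c 1 μ) (c 2))
          (cong (ℕ._+ count 2) (∑-distrib (c 0) (c 1))))))
      where
      c : ℕ → F → ℕ
      c i μ = χ (inFibre μ ×-dec dim μ ℕ.≟ i)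

    weighted-by-dim : ∑ (λ μ → χ (inFibre μ) ℕ.* nonzeroRoots μ) ≡ count 1 ℕ.+ 3 ℕ.* count 2 ℕ.+ 7 ℕ.* count 3
    weighted-by-dim =
      trans (∑-cong (λ μ → χ-weighted (inFibre μ) (dim μ) (nonzeroRoots μ) (dim≤3 (hasDim μ)) (nonzeroRoots+1≡2^dim μ)))
      (trans (∑-distrib (λ μ → c 1 μ ℕ.+ 3 ℕ.* c 2 μ) (λ μ → 7 ℕ.* c 3 μ))
        (cong₂ ℕ._+_ (trans (∑-distrib (c 1) (λ μ → 3 ℕ.* c 2 μ)) (cong (count 1 ℕ.+_) (∑-scale 3 (c 2))))
                     (∑-scale 7 (c 3))))
      where
      c : ℕ → F → ℕ
      c i μ = χ (inFibre μ ×-dec dim μ ℕ.≟ i)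

    count₀≡2count₂+6count₃ : count 0 ≡ 2 ℕ.* count 2 ℕ.+ 6 ℕ.* count 3
    count₀≡2count₂+6count₃ = cancel-count (trans (sym fibre-by-dim) (trans fibre≡weighted weighted-by-dim))

    count↔Nset : ∀ i → Fin (count i) ↔ Nset m 𝔽 dim α i
    count↔Nset i = count↔ (λ μ → inFibre μ ×-dec dim μ ℕ.≟ i)
      (λ (p , q) (p′ , q′) → cong₂ _,_ (≡-irrelevant p p′) (ℕP.≡-irrelevant q q′))

open import Data.Nat using (_+_; _*_; _≤_; _^_)

proposition3p2 : (m s : ℕ) → 1 ≤ m → 1 ≤ s → gcd (s + m) (3 * m) ≡ 1 →
    (𝔽 : FiniteField2 (3 * m)) →
    (α : FiniteField2.F 𝔽) → InSubfield m 𝔽 α → ¬ (α ≡ FiniteField2.1F 𝔽) →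
    (dim : FiniteField2.F 𝔽 → ℕ) → (∀ μ → HasDimF2 𝔽 (PU m 𝔽 s μ) (dim μ)) →
    (n₀ n₂ n₃ : ℕ) →
    (Fin n₀ ↔ Nset m 𝔽 dim α 0) → (Fin n₂ ↔ Nset m 𝔽 dim α 2) → (Fin n₃ ↔ Nset m 𝔽 dim α 3) →
    n₀ ≡ 2 * n₂ + 6 * n₃
proposition3p2 m s _ _ coprime 𝔽 α _ α≢1 dim hasDim n₀ n₂ n₃ n₀↔ n₂↔ n₃↔ = begin
  n₀                                  ≡⟨ n≡count n₀↔ ⟩
  count 0                             ≡⟨ count₀≡2count₂+6count₃ ⟩
  2 * count 2 + 6 * count 3           ≡⟨ sym (cong₂ (λ a b → 2 * a + 6 * b) (n≡count n₂↔) (n≡count n₃↔)) ⟩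
  2 * n₂ + 6 * n₃                     ∎
  where
  open Setting m s 𝔽 coprime
  open Counting α α≢1 dim hasDim
  open ≡-Reasoning
  n≡count : ∀ {n i} → Fin n ↔ Nset m 𝔽 dim α i → n ≡ count i
  n≡count {i = i} n↔ = ↔⇒≡ (↔-trans n↔ (↔-sym (count↔Nset i)))
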